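{- There is no linear code $C\subseteq\mathbb{F}_9^{7}$ that is a completely regular code in the Hamming graph $H(7,9)$ with intersection array $\{56,42,20;1,6,28\}$.
   Context: The Hamming graph $H(n,q)$ has vertex set $\mathbb{F}_q^n$, two vectors adjacent iff they differ in exactly one coordinate. For a set of vertices $C$, let $C^{(k)}$ be the set of vertices at distance exactly $k$ from $C$, and $\rho$ the largest $k$ with $C^{(k)}\neq\emptyset$. $C$ is a completely regular code if each vertex in $C^{(k)}$ has a number of neighbors in each $C^{(l)}$ depending only on $k,l$, vanishing for $|k-l|>1$; its intersection array is $\{\beta_0,\ldots,\beta_{\rho-1};\gamma_1,\ldots,\gamma_\rho\}$, where $\beta_k$ (resp. $\gamma_k$) is the number of neighbors in $C^{(k+1)}$ (resp. $C^{(k-1)}$) of any vertex in $C^{(k)}$. -}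

module Defs where

open import Data.Nat using (ℕ; zero; suc; _+_; _≤_; _⊓_; _≡ᵇ_)
open import Data.Bool using (Bool; true; false; if_then_else_; _∧_)
open import Data.Fin using (Fin; toℕ)
open import Data.Vec using (Vec; []; _∷_; lookup; zipWith; map)
open import Data.List as List using (List; [_]; concatMap; foldr)
open import Data.Product using (Σ; _×_; ∃)
open import Relation.Binary.PropositionalEquality using (_≡_)

data F₃ : Set where
  f0 f1 f2 : F₃

_+₃_ : F₃ → F₃ → F₃
f0 +₃ y  = y
x  +₃ f0 = x
f1 +₃ f1 = f2
f1 +₃ f2 = f0
f2 +₃ f1 = f0
f2 +₃ f2 = f1

_*₃_ : F₃ → F₃ → F₃
f0 *₃ _  = f0
_  *₃ f0 = f0
f1 *₃ y  = y
x  *₃ f1 = x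
f2 *₃ f2 = f1

-₃_ : F₃ → F₃
-₃ f0 = f0
-₃ f1 = f2
-₃ f2 = f1

_==₃_ : F₃ → F₃ → Bool
f0 ==₃ f0 = true
f1 ==₃ f1 = true
f2 ==₃ f2 = true
_  ==₃ _  = false

allF₃ : List F₃
allF₃ = f0 List.∷ f1 List.∷ f2 List.∷ List.[]

-- The field F₉ = F₃[i]/(i² + 1)  (x² + 1 is irreducible over F₃).
-- An element a + b·i is represented as  mk a b.

record F₉ : Set where
  constructor mk
  field
    re im : F₃

_+₉_ : F₉ → F₉ → F₉
mk a b +₉ mk c d = mk (a +₃ c) (b +₃ d)

-- (a + b i)(c + d i) = (ac - bd) + (ad + bc) i
_*₉_ : F₉ → F₉ → F₉
mk a b *₉ mk c d = mk ((a *₃ c) +₃ (-₃ (b *₃ d))) ((a *₃ d) +₃ (b *₃ c))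

0₉ : F₉
0₉ = mk f0 f0

_==₉_ : F₉ → F₉ → Bool
mk a b ==₉ mk c d = (a ==₃ c) ∧ (b ==₃ d)

allF₉ : List F₉
allF₉ = concatMap (λ a → List.map (mk a) allF₃) allF₃

Word : ℕ → Set
Word n = Vec F₉ n

allWords : (n : ℕ) → List (Word n)
allWords zero    = [ [] ]
allWords (suc n) = concatMap (λ a → List.map (a ∷_) (allWords n)) allF₉

ham : ∀ {n} → Word n → Word n → ℕ
ham []       []       = 0
ham (a ∷ x) (b ∷ y) = (if a ==₉ b then 0 else 1) + ham x y

countᵇ : ∀ {A : Set} → (A → Bool) → List A → ℕ
countᵇ p = foldr (λ a k → if p a then suc k else k) 0

neighbours : ∀ {n} → Word n → List (Word n)
neighbours {n} x = List.filterᵇ (λ y → ham x y ≡ᵇ 1) (allWords n)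

Code : ℕ → Set
Code n = Word n → Bool

zeroWord : ∀ n → Word n
zeroWord n = Data.Vec.replicate n 0₉
  where import Data.Vec

IsLinear : ∀ {n} → Code n → Set
IsLinear {n} C =
  (C (zeroWord n) ≡ true) ×
  (∀ x y → C x ≡ true → C y ≡ true → C (zipWith _+₉_ x y) ≡ true) ×
  (∀ (a : F₉) x → C x ≡ true → C (map (a *₉_) x) ≡ true)

-- distance d(x, C) = min_{c ∈ C} ham x c  (value n+1 only if C is empty)
distC : ∀ {n} → Code n → Word n → ℕ
distC {n} C x =
  foldr _⊓_ (suc n) (List.map (λ c → if C c then ham x c else suc n) (allWords n))

-- C is completely regular with covering radius ρ and intersection array
-- {β₀,…,β_{ρ-1}; γ₁,…,γ_ρ}, where  β k = β_k  and  γ k = γ_{k+1}.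
-- Every vertex of C^(k) has β_k neighbours in C^(k+1) and γ_k neighbours in
-- C^(k-1); the remaining neighbours (56 - β_k - γ_k many in H(7,9), resp.
-- n·8 - β_k - γ_k in general) lie in C^(k), since neighbours' distances to C
-- differ by at most one.
IsCompletelyRegularWithArray :
  ∀ {n} → Code n → (ρ : ℕ) → Vec ℕ ρ → Vec ℕ ρ → Set
IsCompletelyRegularWithArray {n} C ρ β γ =
  (∀ x → distC C x ≤ ρ) ×
  (∃ λ x → distC C x ≡ ρ) ×
  (∀ x (k : Fin ρ) → distC C x ≡ toℕ k →
     countᵇ (λ y → distC C y ≡ᵇ suc (toℕ k)) (neighbours x) ≡ lookup β k) ×
  (∀ x (k : Fin ρ) → distC C x ≡ suc (toℕ k) →
     countᵇ (λ y → distC C y ≡ᵇ toℕ k) (neighbours x) ≡ lookup γ k)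

{-# OPTIONS --safe #-}
-- Suppose C is such a code.  β₀ = 56 = 7·8 and γ₁ = 1 force minimum distance 3, so the codeword
-- closest to a vertex e_i + b·e_k (b ≠ 0) at distance 1 has weight 3 and contains i and k in its
-- support: such vertices correspond to weight-3 codewords, the "lines".  Of the 56 neighbours of
-- e_i exactly 42 lie at distance 2, which leaves six incidences between the other points and the
-- lines through i (normalised at i).  Two lines through the same pair with different third points
-- would produce four points all of whose triples are lines, which the same count excludes; so any
-- two points lie on exactly one line and the lines form a Fano plane.  For each triangle of the
-- Fano plane, eliminating two vertices and then a point of the opposite line leaves a codeword
-- supported off a line, hence zero; so the side codewords restricted to the triangle have
-- vanishing determinant.  Three of these relations contradict each other in characteristic 3.
module Submission where

open import Defs
open import Data.Bool using (Bool; true; false; if_then_else_; not; T; T?)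
open import Data.Empty using (⊥)
open import Data.Fin using (Fin; zero; suc; _≟_)
import Data.Fin.Properties as Fin
open import Data.List as List using (List; []; _∷_; [_]; _++_; length; concatMap; filterᵇ)
open import Data.List.Membership.Propositional using (_∈_)
open import Data.List.Membership.Propositional.Properties using (∈-map⁺; ∈-concatMap⁺; ∈-filter⁺; ∈-filter⁻; ∈-lookup)
import Data.List.Properties as List
open import Data.List.Relation.Unary.All as All using (All; []; _∷_)
import Data.List.Relation.Unary.All.Properties as All
open import Data.List.Relation.Unary.AllPairs using ([]; _∷_; allPairs?)
open import Data.List.Relation.Unary.Any as Any using (here; there)
import Data.List.Relation.Unary.Any.Properties as Any
open import Data.List.Relation.Unary.Unique.Propositional using (Unique)
import Data.List.Relation.Unary.Unique.Propositional.Properties as Unique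
open import Data.Nat using (ℕ; zero; suc; _+_; _*_; _≤_; _<_; _⊓_; _≡ᵇ_; z≤n; s≤s; _≤?_)
open import Data.Nat.ListAction using () renaming (sum to sumˡ)
open import Data.Nat.Properties hiding (_≟_)
open import Data.Nat.Properties using () renaming (_≟_ to _≟ℕ_)
open import Data.Product using (Σ; _×_; _,_; proj₁; proj₂; ∃; ∃₂; uncurry)
open import Data.Sum using (_⊎_; inj₁; inj₂; [_,_]′)
open import Data.Unit using (tt)
open import Data.Vec as Vec using (Vec; []; _∷_; lookup; _[_]≔_; zipWith; map)
import Data.Vec.Properties as Vec
open import Function using (_∘_)
open import Relation.Binary.Definitions using (DecidableEquality)
open import Relation.Binary.PropositionalEquality hiding ([_])
open import Relation.Nullary using (¬_; Dec; yes; no; _because_; ¬?; does; contradiction)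
open import Relation.Nullary.Reflects using (Reflects; ofʸ; ofⁿ)
open import Relation.Nullary.Decidable using (map′; _×-dec_; _→-dec_; from-yes; decidable-stable)
open import Relation.Unary using (Decidable)
open import Algebra.Solver.Ring.AlmostCommutativeRing using (AlmostCommutativeRing)
import Algebra.Solver.Ring.Simple as RingSolver
open import Algebra.Properties.CommutativeMonoid.Sum +-0-commutativeMonoid using (sum; sum-syntax; sum-cong-≗; ∑-distrib-+)
open import Algebra.Properties.CommutativeSemigroup +-commutativeSemigroup
  using () renaming (interchange to +-interchange; x∙yz≈y∙xz to +-left-comm)

infixl 6 _⊕_
infixl 7 _⊗_
infix  8 ⊖_
infix  4 _≟₉_

_⊕_ _⊗_ : F₉ → F₉ → F₉
_⊕_ = _+₉_
_⊗_ = _*₉_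

⊖_ : F₉ → F₉
⊖ mk a b = mk (-₃ a) (-₃ b)

1₉ : F₉
1₉ = mk f1 f0

1≢0 : 1₉ ≢ 0₉
1≢0 ()

==₃-reflects : ∀ a b → Reflects (a ≡ b) (a ==₃ b)
==₃-reflects f0 f0 = ofʸ refl
==₃-reflects f0 f1 = ofⁿ λ ()
==₃-reflects f0 f2 = ofⁿ λ ()
==₃-reflects f1 f0 = ofⁿ λ ()
==₃-reflects f1 f1 = ofʸ refl
==₃-reflects f1 f2 = ofⁿ λ ()
==₃-reflects f2 f0 = ofⁿ λ ()
==₃-reflects f2 f1 = ofⁿ λ ()
==₃-reflects f2 f2 = ofʸ refl

==₉-reflects : ∀ a b → Reflects (a ≡ b) (a ==₉ b)
==₉-reflects (mk a b) (mk c d) with a ==₃ c | ==₃-reflects a c | b ==₃ d | ==₃-reflects b d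
... | true  | ofʸ refl | true  | ofʸ refl = ofʸ refl
... | true  | ofʸ _    | false | ofⁿ b≢d = ofⁿ (b≢d ∘ cong F₉.im)
... | false | ofⁿ a≢c | _     | _        = ofⁿ (a≢c ∘ cong F₉.re)

_≟₉_ : DecidableEquality F₉
a ≟₉ b = (a ==₉ b) because ==₉-reflects a b

==₉-refl : ∀ a → (a ==₉ a) ≡ true
==₉-refl a with a ==₉ a | ==₉-reflects a a
... | true  | _       = refl
... | false | ofⁿ a≢a = contradiction refl a≢a

==₉-≢ : ∀ {a b} → a ≢ b → (a ==₉ b) ≡ false
==₉-≢ {a} {b} a≢b with a ==₉ b | ==₉-reflects a b
... | true  | ofʸ a≡b = contradiction a≡b a≢b
... | false | _        = refl

∀₃? : {P : F₃ → Set} → Decidable P → Dec (∀ a → P a)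
∀₃? P? = map′ (λ { (p₀ , p₁ , p₂) f0 → p₀ ; (p₀ , p₁ , p₂) f1 → p₁ ; (p₀ , p₁ , p₂) f2 → p₂ })
              (λ p → p f0 , p f1 , p f2)
              (P? f0 ×-dec P? f1 ×-dec P? f2)

∀₉? : {P : F₉ → Set} → Decidable P → Dec (∀ a → P a)
∀₉? P? = map′ (λ p (mk a b) → p a b) (λ p a b → p (mk a b)) (∀₃? λ a → ∀₃? λ b → P? (mk a b))

_≢0? : ∀ a → Dec (a ≢ 0₉)
a ≢0? = ¬? (a ≟₉ 0₉)

F₉-ring : AlmostCommutativeRing _ _
F₉-ring = record
  { Carrier = F₉ ; _≈_ = _≡_ ; _+_ = _⊕_ ; _*_ = _⊗_ ; -_ = ⊖_ ; 0# = 0₉ ; 1# = 1₉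
  ; isAlmostCommutativeRing = record
    { isCommutativeSemiring = record
      { isSemiring = record
        { isSemiringWithoutAnnihilatingZero = record
          { +-isCommutativeMonoid = record
            { isMonoid = record
              { isSemigroup = record { isMagma = record { isEquivalence = isEquivalence ; ∙-cong = cong₂ _⊕_ } ; assoc = ⊕-assoc }
              ; identity = ⊕-identityˡ , ⊕-identityʳ }
            ; comm = ⊕-comm }
          ; *-cong = cong₂ _⊗_ ; *-assoc = ⊗-assoc ; *-identity = ⊗-identityˡ , ⊗-identityʳ
          ; distrib = ⊗-distribˡ-⊕ , ⊗-distribʳ-⊕ }
        ; zero = ⊗-zeroˡ , ⊗-zeroʳ }
      ; *-comm = ⊗-comm }
    ; -‿cong = cong ⊖_ ; -‿*-distribˡ = ⊖-distribˡ-⊗ ; -‿+-comm = ⊖-⊕-comm } }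
  where
  ⊕-assoc : ∀ a b c → a ⊕ b ⊕ c ≡ a ⊕ (b ⊕ c)
  ⊕-assoc = from-yes (∀₉? λ a → ∀₉? λ b → ∀₉? λ c → a ⊕ b ⊕ c ≟₉ a ⊕ (b ⊕ c))
  ⊕-comm : ∀ a b → a ⊕ b ≡ b ⊕ a
  ⊕-comm = from-yes (∀₉? λ a → ∀₉? λ b → a ⊕ b ≟₉ b ⊕ a)
  ⊕-identityˡ : ∀ a → 0₉ ⊕ a ≡ a
  ⊕-identityˡ = from-yes (∀₉? λ a → 0₉ ⊕ a ≟₉ a)
  ⊕-identityʳ : ∀ a → a ⊕ 0₉ ≡ a
  ⊕-identityʳ = from-yes (∀₉? λ a → a ⊕ 0₉ ≟₉ a)
  ⊗-assoc : ∀ a b c → a ⊗ b ⊗ c ≡ a ⊗ (b ⊗ c)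
  ⊗-assoc = from-yes (∀₉? λ a → ∀₉? λ b → ∀₉? λ c → a ⊗ b ⊗ c ≟₉ a ⊗ (b ⊗ c))
  ⊗-comm : ∀ a b → a ⊗ b ≡ b ⊗ a
  ⊗-comm = from-yes (∀₉? λ a → ∀₉? λ b → a ⊗ b ≟₉ b ⊗ a)
  ⊗-identityˡ : ∀ a → 1₉ ⊗ a ≡ a
  ⊗-identityˡ = from-yes (∀₉? λ a → 1₉ ⊗ a ≟₉ a)
  ⊗-identityʳ : ∀ a → a ⊗ 1₉ ≡ a
  ⊗-identityʳ = from-yes (∀₉? λ a → a ⊗ 1₉ ≟₉ a)
  ⊗-distribˡ-⊕ : ∀ a b c → a ⊗ (b ⊕ c) ≡ a ⊗ b ⊕ a ⊗ c
  ⊗-distribˡ-⊕ = from-yes (∀₉? λ a → ∀₉? λ b → ∀₉? λ c → a ⊗ (b ⊕ c) ≟₉ a ⊗ b ⊕ a ⊗ c)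
  ⊗-distribʳ-⊕ : ∀ a b c → (b ⊕ c) ⊗ a ≡ b ⊗ a ⊕ c ⊗ a
  ⊗-distribʳ-⊕ = from-yes (∀₉? λ a → ∀₉? λ b → ∀₉? λ c → (b ⊕ c) ⊗ a ≟₉ b ⊗ a ⊕ c ⊗ a)
  ⊗-zeroˡ : ∀ a → 0₉ ⊗ a ≡ 0₉
  ⊗-zeroˡ = from-yes (∀₉? λ a → 0₉ ⊗ a ≟₉ 0₉)
  ⊗-zeroʳ : ∀ a → a ⊗ 0₉ ≡ 0₉
  ⊗-zeroʳ = from-yes (∀₉? λ a → a ⊗ 0₉ ≟₉ 0₉)
  ⊖-distribˡ-⊗ : ∀ a b → ⊖ a ⊗ b ≡ ⊖ (a ⊗ b)
  ⊖-distribˡ-⊗ = from-yes (∀₉? λ a → ∀₉? λ b → ⊖ a ⊗ b ≟₉ ⊖ (a ⊗ b))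
  ⊖-⊕-comm : ∀ a b → ⊖ a ⊕ ⊖ b ≡ ⊖ (a ⊕ b)
  ⊖-⊕-comm = from-yes (∀₉? λ a → ∀₉? λ b → ⊖ a ⊕ ⊖ b ≟₉ ⊖ (a ⊕ b))

open AlmostCommutativeRing F₉-ring using () renaming (zeroʳ to ⊗-zeroʳ)
-- The solver computes with coefficients in F₉, so it proves identities valid only in characteristic 3.
open RingSolver F₉-ring _≟₉_ using (solve; _:+_; _:*_; :-_; _:=_; con)

⊗-≢0 : ∀ a b → a ≢ 0₉ → b ≢ 0₉ → a ⊗ b ≢ 0₉
⊗-≢0 = from-yes (∀₉? λ a → ∀₉? λ b → a ≢0? →-dec (b ≢0? →-dec (a ⊗ b) ≢0?))

a⊗b≡0⇒b≡0 : ∀ a b → a ≢ 0₉ → a ⊗ b ≡ 0₉ → b ≡ 0₉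
a⊗b≡0⇒b≡0 = from-yes (∀₉? λ a → ∀₉? λ b → a ≢0? →-dec (a ⊗ b ≟₉ 0₉ →-dec b ≟₉ 0₉))

⊖-≢0 : ∀ a → a ≢ 0₉ → ⊖ a ≢ 0₉
⊖-≢0 = from-yes (∀₉? λ a → a ≢0? →-dec (⊖ a) ≢0?)

inverse : ∀ a → a ≢ 0₉ → ∃ λ b → b ⊗ a ≡ 1₉
inverse a a≢0 = Any.satisfied (from-yes (∀₉? λ a → a ≢0? →-dec Any.any? (λ b → b ⊗ a ≟₉ 1₉) allF₉) a a≢0)

1⊗a⊕⊖1⊗b≡0⇒a≡b : ∀ a b → 1₉ ⊗ a ⊕ ⊖ 1₉ ⊗ b ≡ 0₉ → a ≡ b
1⊗a⊕⊖1⊗b≡0⇒a≡b = from-yes (∀₉? λ a → ∀₉? λ b → 1₉ ⊗ a ⊕ ⊖ 1₉ ⊗ b ≟₉ 0₉ →-dec a ≟₉ b)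

-- The combination below equals g b t k u because 2 = −1 in F₉.
fano-relations-inconsistent : ∀ a b g h k s t u v → g ≢ 0₉ → b ≢ 0₉ → t ≢ 0₉ → k ≢ 0₉ → u ≢ 0₉ →
  s ⊗ (⊖ a ⊗ h) ⊕ ⊖ (g ⊗ b) ⊗ t ≡ 0₉ →
  u ⊗ (⊖ a ⊗ k) ⊕ ⊖ (g ⊗ b) ⊗ v ≡ 0₉ →
  v ⊗ (⊖ h ⊗ s) ⊕ ⊖ (t ⊗ k) ⊗ u ≡ 0₉ → ⊥
fano-relations-inconsistent a b g h k s t u v g≢0 b≢0 t≢0 k≢0 u≢0 E₁ E₂ E₃ =
  ⊗-≢0 _ _ (⊗-≢0 _ _ (⊗-≢0 _ _ (⊗-≢0 _ _ g≢0 b≢0) t≢0) k≢0) u≢0 (begin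
    g ⊗ b ⊗ t ⊗ k ⊗ u ≡⟨ combination ⟨
    u ⊗ k ⊗ (s ⊗ (⊖ a ⊗ h) ⊕ ⊖ (g ⊗ b) ⊗ t) ⊕ ⊖ (s ⊗ h) ⊗ (u ⊗ (⊖ a ⊗ k) ⊕ ⊖ (g ⊗ b) ⊗ v)
      ⊕ g ⊗ b ⊗ (v ⊗ (⊖ h ⊗ s) ⊕ ⊖ (t ⊗ k) ⊗ u)
      ≡⟨ cong₂ _⊕_ (cong₂ _⊕_ (cong (u ⊗ k ⊗_) E₁) (cong (⊖ (s ⊗ h) ⊗_) E₂)) (cong (g ⊗ b ⊗_) E₃) ⟩
    u ⊗ k ⊗ 0₉ ⊕ ⊖ (s ⊗ h) ⊗ 0₉ ⊕ g ⊗ b ⊗ 0₉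
      ≡⟨ solve 5 (λ u k s h gb → u :* k :* con 0₉ :+ :- (s :* h) :* con 0₉ :+ gb :* con 0₉ := con 0₉) refl u k s h (g ⊗ b) ⟩
    0₉ ∎)
  where
  open ≡-Reasoning
  combination : u ⊗ k ⊗ (s ⊗ (⊖ a ⊗ h) ⊕ ⊖ (g ⊗ b) ⊗ t) ⊕ ⊖ (s ⊗ h) ⊗ (u ⊗ (⊖ a ⊗ k) ⊕ ⊖ (g ⊗ b) ⊗ v)
                  ⊕ g ⊗ b ⊗ (v ⊗ (⊖ h ⊗ s) ⊕ ⊖ (t ⊗ k) ⊗ u) ≡ g ⊗ b ⊗ t ⊗ k ⊗ u
  combination = solve 9 (λ a b g h k s t u v →
    u :* k :* (s :* (:- a :* h) :+ :- (g :* b) :* t) :+ :- (s :* h) :* (u :* (:- a :* k) :+ :- (g :* b) :* v)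
      :+ g :* b :* (v :* (:- h :* s) :+ :- (t :* k) :* u) := g :* b :* t :* k :* u) refl a b g h k s t u v

∈-allF₉ : ∀ a → a ∈ allF₉
∈-allF₉ = from-yes (∀₉? λ a → Any.any? (a ≟₉_) allF₉)

allF₉-unique : Unique allF₉
allF₉-unique = from-yes (allPairs? (λ a b → ¬? (a ≟₉ b)) allF₉)

others : F₉ → List F₉
others a = filterᵇ (λ b → not (a ==₉ b)) allF₉

length-others : ∀ a → length (others a) ≡ 8
length-others = from-yes (∀₉? λ a → length (others a) ≟ℕ 8)

others-unique : ∀ a → Unique (others a)
others-unique a = Unique.filter⁺ (T? ∘ λ b → not (a ==₉ b)) allF₉-unique

∈-others : ∀ {a b} → b ≢ a → b ∈ others a
∈-others {a} {b} b≢a =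
  ∈-filter⁺ (T? ∘ λ b → not (a ==₉ b)) (∈-allF₉ b) (subst (T ∘ not) (sym (==₉-≢ (b≢a ∘ sym))) tt)

∈-others⁻ : ∀ {a b} → b ∈ others a → b ≢ a
∈-others⁻ {a} {b} b∈ refl with ∈-filter⁻ (T? ∘ λ b → not (a ==₉ b)) {xs = allF₉} b∈
... | _ , T[not[a==a]] rewrite ==₉-refl a = T[not[a==a]]

variable
  A B : Set

count≤length : ∀ (p : A → Bool) xs → countᵇ p xs ≤ length xs
count≤length p [] = z≤n
count≤length p (x ∷ xs) with p x
... | true  = s≤s (count≤length p xs)
... | false = m≤n⇒m≤1+n (count≤length p xs)

count≡length⇒all : ∀ (p : A → Bool) xs → countᵇ p xs ≡ length xs → ∀ {x} → x ∈ xs → p x ≡ true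
count≡length⇒all p (y ∷ xs) eq x∈ with p y in py
count≡length⇒all p (y ∷ xs) eq (here refl) | true = py
count≡length⇒all p (y ∷ xs) eq (there x∈) | true = count≡length⇒all p xs (suc-injective eq) x∈
... | false = contradiction (subst (_≤ length xs) eq (count≤length p xs)) 1+n≰n

count-all : ∀ (p : A → Bool) xs → (∀ {x} → x ∈ xs → p x ≡ true) → countᵇ p xs ≡ length xs
count-all p [] _ = refl
count-all p (x ∷ xs) all rewrite all (here refl) = cong suc (count-all p xs (all ∘ there))

count-none : ∀ (p : A → Bool) xs → (∀ {x} → x ∈ xs → p x ≡ false) → countᵇ p xs ≡ 0
count-none p [] _ = refl
count-none p (x ∷ xs) none rewrite none (here refl) = count-none p xs (none ∘ there)

count-complement : ∀ (p q : A → Bool) xs → (∀ {x} → x ∈ xs → p x ≡ not (q x)) →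
  countᵇ p xs + countᵇ q xs ≡ length xs
count-complement p q [] _ = refl
count-complement p q (x ∷ xs) p≡¬q with p x | q x | p≡¬q (here refl)
... | true  | false | _ = cong suc (count-complement p q xs (p≡¬q ∘ there))
... | false | true  | _ = trans (+-suc _ _) (cong suc (count-complement p q xs (p≡¬q ∘ there)))

count≥1 : ∀ (p : A → Bool) {x} xs → x ∈ xs → p x ≡ true → 1 ≤ countᵇ p xs
count≥1 p (y ∷ xs) (here refl) px rewrite px = s≤s z≤n
count≥1 p (y ∷ xs) (there x∈) px with p y
... | true  = s≤s z≤n
... | false = count≥1 p xs x∈ px

count≥2 : ∀ (p : A → Bool) {x y} xs → x ≢ y → x ∈ xs → y ∈ xs → p x ≡ true → p y ≡ true → 2 ≤ countᵇ p xs
count≥2 p (z ∷ xs) x≢y (here refl) (here refl) px py = contradiction refl x≢y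
count≥2 p (z ∷ xs) x≢y (here refl) (there y∈) px py rewrite px = s≤s (count≥1 p xs y∈ py)
count≥2 p (z ∷ xs) x≢y (there x∈) (here refl) px py rewrite py = s≤s (count≥1 p xs x∈ px)
count≥2 p (z ∷ xs) x≢y (there x∈) (there y∈) px py with p z
... | true  = ≤-trans (count≥2 p xs x≢y x∈ y∈ px py) (n≤1+n _)
... | false = count≥2 p xs x≢y x∈ y∈ px py

count≥1⇒∃ : ∀ (p : A → Bool) xs → 1 ≤ countᵇ p xs → ∃ λ x → x ∈ xs × p x ≡ true
count≥1⇒∃ p (x ∷ xs) 1≤ with p x in px
... | true  = x , here refl , px
... | false with count≥1⇒∃ p xs 1≤
...   | y , y∈ , py = y , there y∈ , py

count≥2⇒∃₂ : ∀ (p : A → Bool) {xs} → Unique xs → 2 ≤ countᵇ p xs →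
  ∃₂ λ x y → x ≢ y × x ∈ xs × y ∈ xs × p x ≡ true × p y ≡ true
count≥2⇒∃₂ p {x ∷ xs} (x∉xs ∷ unique) 2≤ with p x in px
... | false with count≥2⇒∃₂ p unique 2≤
...   | y , z , y≢z , y∈ , z∈ , py , pz = y , z , y≢z , there y∈ , there z∈ , py , pz
count≥2⇒∃₂ p {x ∷ xs} (x∉xs ∷ unique) (s≤s 1≤) | true with count≥1⇒∃ p xs 1≤
... | y , y∈ , py = x , y , All.lookup x∉xs y∈ , here refl , there y∈ , px , py

count-++ : ∀ (p : A → Bool) xs ys → countᵇ p (xs ++ ys) ≡ countᵇ p xs + countᵇ p ys
count-++ p [] ys = refl
count-++ p (x ∷ xs) ys with p x
... | true  = cong suc (count-++ p xs ys)
... | false = count-++ p xs ys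

count-map : ∀ (p : B → Bool) (f : A → B) xs → countᵇ p (List.map f xs) ≡ countᵇ (p ∘ f) xs
count-map p f [] = refl
count-map p f (x ∷ xs) with p (f x)
... | true  = cong suc (count-map p f xs)
... | false = count-map p f xs

count-concatMap-if : ∀ (c : A → Bool) (p : B → Bool) (L : List B) (f : A → B) xs →
  countᵇ p (concatMap (λ b → if c b then L else [ f b ]) xs)
    ≡ countᵇ c xs * countᵇ p L + countᵇ (p ∘ f) (filterᵇ (not ∘ c) xs)
count-concatMap-if c p L f [] = refl
count-concatMap-if c p L f (x ∷ xs) with c x
... | true = begin
  countᵇ p (L ++ rest)                                  ≡⟨ count-++ p L rest ⟩
  countᵇ p L + countᵇ p rest                            ≡⟨ cong (countᵇ p L +_) (count-concatMap-if c p L f xs) ⟩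
  countᵇ p L + (countᵇ c xs * countᵇ p L + remaining)   ≡⟨ +-assoc (countᵇ p L) _ remaining ⟨
  countᵇ p L + countᵇ c xs * countᵇ p L + remaining     ∎
  where
  open ≡-Reasoning
  rest = concatMap (λ b → if c b then L else [ f b ]) xs
  remaining = countᵇ (p ∘ f) (filterᵇ (not ∘ c) xs)
... | false with p (f x)
...   | true  = trans (cong suc (count-concatMap-if c p L f xs)) (sym (+-suc _ _))
...   | false = count-concatMap-if c p L f xs

filterᵇ-concatMap : ∀ (p : B → Bool) (f : A → List B) xs →
  filterᵇ p (concatMap f xs) ≡ concatMap (filterᵇ p ∘ f) xs
filterᵇ-concatMap p f [] = refl
filterᵇ-concatMap p f (x ∷ xs) =
  trans (List.filter-++ _ (f x) (concatMap f xs)) (cong (filterᵇ p (f x) ++_) (filterᵇ-concatMap p f xs))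

filterᵇ-map : ∀ (p : B → Bool) (f : A → B) xs →
  filterᵇ p (List.map f xs) ≡ List.map f (filterᵇ (p ∘ f) xs)
filterᵇ-map p f [] = refl
filterᵇ-map p f (x ∷ xs) with p (f x)
... | true  = cong (f x ∷_) (filterᵇ-map p f xs)
... | false = filterᵇ-map p f xs

only-candidate : ∀ {A : Set} {t x : A} xs ys → t ∈ xs ++ x ∷ ys → All (t ≢_) xs → All (t ≢_) ys → t ≡ x
only-candidate []       ys (here t≡x)   _          _     = t≡x
only-candidate []       ys (there t∈ys) _          t∉ys = contradiction t∈ys (All.All¬⇒¬Any t∉ys)
only-candidate (z ∷ xs) ys (here t≡z)   (t≢z ∷ _)  _     = contradiction t≡z t≢z
only-candidate (z ∷ xs) ys (there t∈)   (_ ∷ t∉xs) t∉ys = only-candidate xs ys t∈ t∉xs t∉ys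

≡ᵇ-true : ∀ {m n} → m ≡ n → (m ≡ᵇ n) ≡ true
≡ᵇ-true {zero}  refl = refl
≡ᵇ-true {suc m} refl = ≡ᵇ-true {m} refl

≡ᵇ-sound : ∀ m n → (m ≡ᵇ n) ≡ true → m ≡ n
≡ᵇ-sound zero    zero    _ = refl
≡ᵇ-sound (suc m) (suc n) e = cong suc (≡ᵇ-sound m n e)

≡ᵇ-false : ∀ {m n} → m ≢ n → (m ≡ᵇ n) ≡ false
≡ᵇ-false {m} {n} m≢n with m ≡ᵇ n in eq
... | true  = contradiction (≡ᵇ-sound m n eq) m≢n
... | false = refl

≡ᵇ2≡not≡ᵇ1 : ∀ {d} → 1 ≤ d → d ≤ 2 → (d ≡ᵇ 2) ≡ not (d ≡ᵇ 1)
≡ᵇ2≡not≡ᵇ1 (s≤s z≤n) (s≤s z≤n)       = refl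
≡ᵇ2≡not≡ᵇ1 (s≤s z≤n) (s≤s (s≤s z≤n)) = refl

∑-const : ∀ n c → ∑[ k < n ] c ≡ n * c
∑-const zero    c = refl
∑-const (suc n) c = cong (c +_) (∑-const n c)

∑-mono : ∀ {n} {f g : Fin n → ℕ} → (∀ k → f k ≤ g k) → ∑[ k < n ] f k ≤ ∑[ k < n ] g k
∑-mono {zero}  f≤g = z≤n
∑-mono {suc n} f≤g = +-mono-≤ (f≤g zero) (∑-mono (f≤g ∘ suc))

∑-≤-≡ : ∀ {n} {f g : Fin n → ℕ} → (∀ k → f k ≤ g k) → ∑[ k < n ] f k ≡ ∑[ k < n ] g k → ∀ k → f k ≡ g k
∑-≤-≡ {suc n} {f} {g} f≤g ∑f≡∑g = pointwise
  where
  head≡ : f zero ≡ g zero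
  head≡ = ≤-antisym (f≤g zero)
    (+-cancelʳ-≤ _ _ _ (≤-trans (≤-reflexive (sym ∑f≡∑g)) (+-monoʳ-≤ (f zero) (∑-mono (f≤g ∘ suc)))))
  pointwise : ∀ k → f k ≡ g k
  pointwise zero    = head≡
  pointwise (suc k) = ∑-≤-≡ (f≤g ∘ suc) (+-cancelˡ-≡ (g zero) _ _ (trans (cong (_+ _) (sym head≡)) ∑f≡∑g)) k

zeroAt : ∀ {n} → Fin n → (Fin n → ℕ) → Fin n → ℕ
zeroAt k f m = if does (m ≟ k) then 0 else f m

zeroAt-≢ : ∀ {n} {k m : Fin n} (f : Fin n → ℕ) → m ≢ k → zeroAt k f m ≡ f m
zeroAt-≢ {k = k} {m} f m≢k with m ≟ k
... | yes m≡k = contradiction m≡k m≢k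
... | no _    = refl

∑-zeroAt : ∀ {n} (f : Fin n → ℕ) k → ∑[ m < n ] f m ≡ f k + ∑[ m < n ] zeroAt k f m
∑-zeroAt f zero    = refl
∑-zeroAt {suc n} f (suc k) =
  trans (cong (f zero +_) (∑-zeroAt (f ∘ suc) k)) (+-left-comm (f zero) (f (suc k)) (∑[ m < n ] zeroAt k (f ∘ suc) m))

∑-≥-distinct : ∀ {n} (f : Fin n → ℕ) {ks} → Unique ks → sumˡ (List.map f ks) ≤ ∑[ k < n ] f k
∑-≥-distinct f {[]} [] = z≤n
∑-≥-distinct f {k ∷ ks} (k∉ks ∷ unique) = begin
  f k + sumˡ (List.map f ks)
    ≡⟨ cong (λ s → f k + sumˡ s) (List.map-cong-local (All.map (λ k≢m → sym (zeroAt-≢ f (≢-sym k≢m))) k∉ks)) ⟩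
  f k + sumˡ (List.map (zeroAt k f) ks)   ≤⟨ +-monoʳ-≤ (f k) (∑-≥-distinct (zeroAt k f) unique) ⟩
  f k + ∑[ m < _ ] zeroAt k f m           ≡⟨ ∑-zeroAt f k ⟨
  ∑[ m < _ ] f m                          ∎
  where open ≤-Reasoning

module _ {n : ℕ} where

  lookup-injective : ∀ {xs : List (Fin n)} → Unique xs → ∀ {a b} → List.lookup xs a ≡ List.lookup xs b → a ≡ b
  lookup-injective (x∉ ∷ _) {zero}  {zero}  _  = refl
  lookup-injective (x∉ ∷ _) {zero}  {suc b} eq = contradiction eq (All.lookup x∉ (∈-lookup b))
  lookup-injective (x∉ ∷ _) {suc a} {zero}  eq = contradiction (sym eq) (All.lookup x∉ (∈-lookup a))
  lookup-injective (_ ∷ unique) {suc a} {suc b} eq = cong suc (lookup-injective unique eq)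

  unique-length≤ : ∀ {xs : List (Fin n)} → Unique xs → length xs ≤ n
  unique-length≤ unique = Fin.injective⇒≤ (lookup-injective unique)

  missing-point : ∀ (xs : List (Fin n)) → length xs < n → ∃ λ p → All (p ≢_) xs
  missing-point xs len<n with Fin.¬∀⟶∃¬ n (_∈ xs) (λ p → Any.any? (p ≟_) xs) all-listed⇒⊥
    where
    all-listed⇒⊥ : ¬ (∀ p → p ∈ xs)
    all-listed⇒⊥ listed = <⇒≱ len<n (Fin.injective⇒≤ {f = Any.index ∘ listed}
      λ {a} {b} eq → trans (Any.lookup-index (listed a)) (trans (cong (List.lookup xs) eq) (sym (Any.lookup-index (listed b)))))
  ... | p , p∉xs = p , All.¬Any⇒All¬ xs p∉xs

  every-point-listed : ∀ {xs : List (Fin n)} → Unique xs → length xs ≡ n → ∀ p → p ∈ xs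
  every-point-listed {xs} unique len≡n p with Any.any? (p ≟_) xs
  ... | yes p∈xs = p∈xs
  ... | no  p∉xs = contradiction (unique-length≤ (All.¬Any⇒All¬ xs p∉xs ∷ unique)) (<⇒≱ (≤-reflexive (cong suc (sym len≡n))))

lookup-ext : ∀ {n} {x y : Vec A n} → (∀ k → lookup x k ≡ lookup y k) → x ≡ y
lookup-ext {x = x} {y} x≗y = trans (sym (Vec.tabulate∘lookup x)) (trans (Vec.tabulate-cong x≗y) (Vec.tabulate∘lookup y))

δ : F₉ → F₉ → ℕ
δ a b = if a ==₉ b then 0 else 1

δ-triangle : ∀ a b c → δ a c ≤ δ a b + δ b c
δ-triangle = from-yes (∀₉? λ a → ∀₉? λ b → ∀₉? λ c → δ a c ≤? δ a b + δ b c)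

δ-refl : ∀ a → δ a a ≡ 0
δ-refl a rewrite ==₉-refl a = refl

ham-refl : ∀ {n} (x : Word n) → ham x x ≡ 0
ham-refl []      = refl
ham-refl (a ∷ x) = cong₂ _+_ (δ-refl a) (ham-refl x)

ham≡0⇒≡ : ∀ {n} {x y : Word n} → ham x y ≡ 0 → x ≡ y
ham≡0⇒≡ {x = []} {[]} _ = refl
ham≡0⇒≡ {x = a ∷ x} {b ∷ y} h≡0 with a ==₉ b | ==₉-reflects a b
... | true  | ofʸ refl = cong (a ∷_) (ham≡0⇒≡ h≡0)

ham-triangle : ∀ {n} (x y z : Word n) → ham x z ≤ ham x y + ham y z
ham-triangle []      []      []      = z≤n
ham-triangle (a ∷ x) (b ∷ y) (c ∷ z) =
  ≤-trans (+-mono-≤ (δ-triangle a b c) (ham-triangle x y z)) (≤-reflexive (+-interchange (δ a b) (δ b c) (ham x y) (ham y z)))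

ham-≤1 : ∀ {n} {x y : Word n} m → (∀ l → l ≢ m → lookup x l ≡ lookup y l) → ham x y ≤ 1
ham-≤1 {x = a ∷ x} {b ∷ y} zero agree
  rewrite lookup-ext {x = x} {y} (λ l → agree (suc l) λ ()) | ham-refl y = ≤-trans (≤-reflexive (+-identityʳ (δ a b))) (δ≤1 a b)
  where
  δ≤1 : ∀ a b → δ a b ≤ 1
  δ≤1 a b with a ==₉ b
  ... | true  = z≤n
  ... | false = s≤s z≤n
ham-≤1 {x = a ∷ x} {b ∷ y} (suc m) agree rewrite agree zero (λ ()) | δ-refl b =
  ham-≤1 {x = x} {y} m (λ l l≢m → agree (suc l) (l≢m ∘ Fin.suc-injective))

ham≡1⇒differ-once : ∀ {n} {x y : Word n} → ham x y ≡ 1 →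
  ∃ λ m → lookup x m ≢ lookup y m × (∀ l → l ≢ m → lookup x l ≡ lookup y l)
ham≡1⇒differ-once {x = []} {[]} ()
ham≡1⇒differ-once {x = a ∷ x} {b ∷ y} h≡1 with a ==₉ b | ==₉-reflects a b
... | true  | ofʸ refl with ham≡1⇒differ-once {x = x} {y} h≡1
...   | m , differ , agree = suc m , differ , λ { zero _ → refl ; (suc l) l≢m → agree l (l≢m ∘ cong suc) }
ham≡1⇒differ-once {x = a ∷ x} {b ∷ y} h≡1 | false | ofⁿ a≢b =
  zero , a≢b , λ { zero 0≢0 → contradiction refl 0≢0
                 ; (suc l) _ → cong (λ v → lookup v l) (ham≡0⇒≡ {x = x} {y} (suc-injective h≡1)) }

ham≤n : ∀ {n} (x y : Word n) → ham x y ≤ n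
ham≤n []      []      = z≤n
ham≤n (a ∷ x) (b ∷ y) with a ==₉ b
... | true  = m≤n⇒m≤1+n (ham≤n x y)
... | false = s≤s (ham≤n x y)

∈-allWords : ∀ {n} (x : Word n) → x ∈ allWords n
∈-allWords []      = here refl
∈-allWords {suc n} (a ∷ x) =
  ∈-concatMap⁺ (λ b → List.map (b ∷_) (allWords n)) (Any.map (λ { refl → ∈-map⁺ (a ∷_) (∈-allWords x) }) (∈-allF₉ a))

allF₉-matches-once : ∀ a (f : F₉ → B) →
  concatMap (λ b → if a ==₉ b then [ f b ] else []) allF₉ ≡ [ f a ]
allF₉-matches-once (mk f0 f0) f = refl
allF₉-matches-once (mk f0 f1) f = refl
allF₉-matches-once (mk f0 f2) f = refl
allF₉-matches-once (mk f1 f0) f = refl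
allF₉-matches-once (mk f1 f1) f = refl
allF₉-matches-once (mk f1 f2) f = refl
allF₉-matches-once (mk f2 f0) f = refl
allF₉-matches-once (mk f2 f1) f = refl
allF₉-matches-once (mk f2 f2) f = refl

count-allF₉-≡ : ∀ a → countᵇ (a ==₉_) allF₉ ≡ 1
count-allF₉-≡ = from-yes (∀₉? λ a → countᵇ (a ==₉_) allF₉ ≟ℕ 1)

filterᵇ-allWords-∷ : ∀ {n} (p : Word (suc n) → Bool) →
  filterᵇ p (allWords (suc n)) ≡ concatMap (λ b → List.map (b ∷_) (filterᵇ (p ∘ (b ∷_)) (allWords n))) allF₉
filterᵇ-allWords-∷ {n} p =
  trans (filterᵇ-concatMap p (λ b → List.map (b ∷_) (allWords n)) allF₉)
        (List.concatMap-cong (λ b → filterᵇ-map p (b ∷_) (allWords n)) allF₉)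

allWords-at-distance-0 : ∀ {n} (x : Word n) → filterᵇ (λ y → ham x y ≡ᵇ 0) (allWords n) ≡ [ x ]
allWords-at-distance-0 [] = refl
allWords-at-distance-0 (a ∷ x) =
  trans (filterᵇ-allWords-∷ (λ y → ham (a ∷ x) y ≡ᵇ 0))
        (trans (List.concatMap-cong only-a allF₉) (allF₉-matches-once a (_∷ x)))
  where
  only-a : ∀ b → List.map (b ∷_) (filterᵇ (λ y → δ a b + ham x y ≡ᵇ 0) (allWords _))
                 ≡ (if a ==₉ b then [ b ∷ x ] else [])
  only-a b with a ==₉ b
  ... | true  = cong (List.map (b ∷_)) (allWords-at-distance-0 x)
  ... | false = cong (List.map (b ∷_)) (filterᵇ-none (allWords _))
    where
    filterᵇ-none : ∀ (xs : List A) → filterᵇ (λ _ → false) xs ≡ []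
    filterᵇ-none [] = refl
    filterᵇ-none (_ ∷ xs) = filterᵇ-none xs

neighbours-∷ : ∀ {n} a (x : Word n) →
  neighbours (a ∷ x) ≡ concatMap (λ b → if a ==₉ b then List.map (a ∷_) (neighbours x) else [ b ∷ x ]) allF₉
neighbours-∷ a x =
  trans (filterᵇ-allWords-∷ (λ y → ham (a ∷ x) y ≡ᵇ 1)) (List.concatMap-cong split allF₉)
  where
  split : ∀ b → List.map (b ∷_) (filterᵇ (λ y → δ a b + ham x y ≡ᵇ 1) (allWords _))
                ≡ (if a ==₉ b then List.map (a ∷_) (neighbours x) else [ b ∷ x ])
  split b with a ==₉ b | ==₉-reflects a b
  ... | true  | ofʸ refl = refl
  ... | false | _        = cong (List.map (b ∷_)) (allWords-at-distance-0 x)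

count-neighbours : ∀ {n} (p : Word n → Bool) (x : Word n) →
  countᵇ p (neighbours x) ≡ ∑[ k < n ] countᵇ (λ b → p (x [ k ]≔ b)) (others (lookup x k))
count-neighbours p [] = refl
count-neighbours {suc n} p (a ∷ x) = begin
  countᵇ p (neighbours (a ∷ x))                     ≡⟨ cong (countᵇ p) (neighbours-∷ a x) ⟩
  countᵇ p (concatMap (λ b → if a ==₉ b then inner else [ b ∷ x ]) allF₉)
                                                    ≡⟨ count-concatMap-if (a ==₉_) p inner (_∷ x) allF₉ ⟩
  countᵇ (a ==₉_) allF₉ * countᵇ p inner + first    ≡⟨ cong (λ m → m * countᵇ p inner + first) (count-allF₉-≡ a) ⟩
  countᵇ p inner + 0 + first                        ≡⟨ cong (_+ first) (+-identityʳ _) ⟩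
  countᵇ p inner + first                            ≡⟨ +-comm _ first ⟩
  first + countᵇ p inner                            ≡⟨ cong (first +_) (count-map p (a ∷_) (neighbours x)) ⟩
  first + countᵇ (p ∘ (a ∷_)) (neighbours x)        ≡⟨ cong (first +_) (count-neighbours (p ∘ (a ∷_)) x) ⟩
  first + ∑[ k < n ] countᵇ (λ b → p (a ∷ (x [ k ]≔ b))) (others (lookup x k)) ∎
  where
  open ≡-Reasoning
  inner = List.map (a ∷_) (neighbours x)
  first = countᵇ (λ b → p (b ∷ x)) (others a)

module _ {n} (C : Code n) (x : Word n) where

  private
    distance-to : Word n → ℕ
    distance-to c = if C c then ham x c else suc n

  distC≤ham : ∀ {c} → C c ≡ true → distC C x ≤ ham x c
  distC≤ham {c} c∈C =
    List.foldr-preservesᵒ {P = _≤ ham x c} {f = _⊓_}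
      (λ a b → [ ≤-trans (m⊓n≤m a b) , ≤-trans (m⊓n≤n a b) ]′) (suc n) _
      (inj₂ (Any.map⁺ (Any.map (λ { refl → ≤-reflexive (cong (λ b → if b then ham x c else suc n) c∈C) }) (∈-allWords c))))

  distC-attained : ∀ {c₀} → C c₀ ≡ true → ∃ λ c → C c ≡ true × distC C x ≡ ham x c
  distC-attained {c₀} c₀∈C with foldr-attains
    where
    Attained : ℕ → Set
    Attained v = v ≡ suc n ⊎ ∃ λ c → C c ≡ true × v ≡ ham x c
    ⊓-attains : ∀ {a b} → Attained a → Attained b → Attained (a ⊓ b)
    ⊓-attains {a} {b} pa pb = [ (λ eq → subst Attained (sym eq) pa) , (λ eq → subst Attained (sym eq) pb) ]′ (⊓-sel a b)
    attained : ∀ c → Attained (distance-to c)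
    attained c with C c in c∈C
    ... | true  = inj₂ (c , c∈C , refl)
    ... | false = inj₁ refl
    foldr-attains : Attained (distC C x)
    foldr-attains = List.foldr-preservesᵇ {P = Attained} {f = _⊓_} ⊓-attains (inj₁ refl)
                      (All.map⁺ (All.universal attained (allWords n)))
  ... | inj₂ attained-at-c = attained-at-c
  ... | inj₁ distC≡1+n = contradiction (≤-trans (≤-reflexive (sym distC≡1+n)) (≤-trans (distC≤ham c₀∈C) (ham≤n x c₀))) 1+n≰n

SupportedOn : ∀ {n} → List (Fin n) → Word n → Set
SupportedOn S w = ∀ m → All (m ≢_) S → lookup w m ≡ 0₉

supported-drop : ∀ {n} {i : Fin n} {S w} → lookup w i ≡ 0₉ → SupportedOn (i ∷ S) w → SupportedOn S w
supported-drop {i = i} wᵢ≡0 supp m m∉S with m ≟ i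
... | yes refl = wᵢ≡0
... | no  m≢i  = supp m (m≢i ∷ m∉S)

unit : ∀ {n} → Fin n → F₉ → Word n
unit {n} i a = zeroWord n [ i ]≔ a

lookup-zeroWord : ∀ {n} m → lookup (zeroWord n) m ≡ 0₉
lookup-zeroWord {n} m = Vec.lookup-replicate m 0₉

lookup-unit : ∀ {n} (i : Fin n) a → lookup (unit i a) i ≡ a
lookup-unit {n} i a = Vec.lookup∘update i (zeroWord n) a

lookup-unit-≢ : ∀ {n} {i m : Fin n} a → m ≢ i → lookup (unit i a) m ≡ 0₉
lookup-unit-≢ {n} {m = m} a m≢i = trans (Vec.lookup∘update′ m≢i (zeroWord n) a) (lookup-zeroWord m)

unit-0 : ∀ {n} (i : Fin n) → unit i 0₉ ≡ zeroWord n
unit-0 {n} i = lookup-ext λ m → case (m ≟ i)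
  where
  case : ∀ {m} → Dec (m ≡ i) → lookup (unit i 0₉) m ≡ lookup (zeroWord n) m
  case {m} (yes refl) = trans (lookup-unit m 0₉) (sym (lookup-zeroWord m))
  case {m} (no m≢i)   = trans (lookup-unit-≢ 0₉ m≢i) (sym (lookup-zeroWord m))

eliminate : ∀ {n} → Fin n → Word n → Word n → Word n
eliminate p u v = zipWith _⊕_ (map (lookup v p ⊗_) u) (map (⊖ lookup u p ⊗_) v)

module _ {n} (p : Fin n) (u v : Word n) where

  lookup-eliminate : ∀ m → lookup (eliminate p u v) m ≡ lookup v p ⊗ lookup u m ⊕ ⊖ lookup u p ⊗ lookup v m
  lookup-eliminate m = trans (Vec.lookup-zipWith _⊕_ m (map (lookup v p ⊗_) u) (map (⊖ lookup u p ⊗_) v))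
                             (cong₂ _⊕_ (Vec.lookup-map m (lookup v p ⊗_) u) (Vec.lookup-map m (⊖ lookup u p ⊗_) v))

  eliminate-pivot : lookup (eliminate p u v) p ≡ 0₉
  eliminate-pivot = trans (lookup-eliminate p) (solve 2 (λ a b → b :* a :+ :- a :* b := con 0₉) refl (lookup u p) (lookup v p))

  eliminate-left : ∀ {m} → lookup v m ≡ 0₉ → lookup (eliminate p u v) m ≡ lookup v p ⊗ lookup u m
  eliminate-left {m} v₀ = trans (lookup-eliminate m)
    (trans (cong (λ y → lookup v p ⊗ lookup u m ⊕ ⊖ lookup u p ⊗ y) v₀)
           (solve 3 (λ a b c → a :* c :+ b :* con 0₉ := a :* c) refl (lookup v p) (⊖ lookup u p) (lookup u m)))

  eliminate-right : ∀ {m} → lookup u m ≡ 0₉ → lookup (eliminate p u v) m ≡ ⊖ lookup u p ⊗ lookup v m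
  eliminate-right {m} u₀ = trans (lookup-eliminate m)
    (trans (cong (λ y → lookup v p ⊗ y ⊕ ⊖ lookup u p ⊗ lookup v m) u₀)
           (solve 3 (λ a b c → a :* con 0₉ :+ b :* c := b :* c) refl (lookup v p) (⊖ lookup u p) (lookup v m)))

  eliminate-supported : ∀ {S T} → SupportedOn (p ∷ S) u → SupportedOn (p ∷ T) v → SupportedOn (S ++ T) (eliminate p u v)
  eliminate-supported {S} u-supp v-supp m m∉S++T with m ≟ p
  ... | yes refl = eliminate-pivot
  ... | no m≢p = trans (lookup-eliminate m)
    (trans (cong₂ (λ y z → lookup v p ⊗ y ⊕ ⊖ lookup u p ⊗ z)
                  (u-supp m (m≢p ∷ All.++⁻ˡ S m∉S++T)) (v-supp m (m≢p ∷ All.++⁻ʳ S m∉S++T)))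
           (solve 2 (λ a b → a :* con 0₉ :+ b :* con 0₉ := con 0₉) refl (lookup v p) (⊖ lookup u p)))

module LinearCode {n} {C : Code n} (linear : IsLinear C) where

  0∈C : C (zeroWord n) ≡ true
  0∈C = proj₁ linear

  eliminate-∈C : ∀ p {u v} → C u ≡ true → C v ≡ true → C (eliminate p u v) ≡ true
  eliminate-∈C p {u} {v} u∈C v∈C =
    proj₁ (proj₂ linear) _ _ (proj₂ (proj₂ linear) (lookup v p) u u∈C) (proj₂ (proj₂ linear) (⊖ lookup u p) v v∈C)

  ∈C⇒distC≡0 : ∀ {x} → C x ≡ true → distC C x ≡ 0
  ∈C⇒distC≡0 {x} x∈C = n≤0⇒n≡0 (≤-trans (distC≤ham C x x∈C) (≤-reflexive (ham-refl x)))

  distC≡0⇒∈C : ∀ {x} → distC C x ≡ 0 → C x ≡ true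
  distC≡0⇒∈C {x} d≡0 with distC-attained C x 0∈C
  ... | c , c∈C , d≡ham = subst (λ y → C y ≡ true) (sym (ham≡0⇒≡ (trans (sym d≡ham) d≡0))) c∈C

  ∉C⇒distC≥1 : ∀ {x} → C x ≢ true → 1 ≤ distC C x
  ∉C⇒distC≥1 {x} x∉C with distC C x in d≡
  ... | zero  = contradiction (distC≡0⇒∈C d≡) x∉C
  ... | suc _ = s≤s z≤n

module MinimumDistance {n} {C : Code n} (linear : IsLinear C)
  (β₀ : ∀ x → distC C x ≡ 0 → countᵇ (λ y → distC C y ≡ᵇ 1) (neighbours x) ≡ n * 8)
  (γ₁ : ∀ x → distC C x ≡ 1 → countᵇ (λ y → distC C y ≡ᵇ 0) (neighbours x) ≡ 1) where

  open LinearCode linear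

  distC-unit : ∀ i {a} → a ≢ 0₉ → distC C (unit i a) ≡ 1
  distC-unit i {a} a≢0 = ≡ᵇ-sound _ 1
    (count≡length⇒all (at i) (others (lookup (zeroWord n) i)) (all-at-distance-1 i)
      (∈-others (λ a≡ → a≢0 (trans a≡ (lookup-zeroWord i)))))
    where
    at : Fin n → F₉ → Bool
    at k b = distC C (zeroWord n [ k ]≔ b) ≡ᵇ 1
    all-at-distance-1 : ∀ k → countᵇ (at k) (others (lookup (zeroWord n) k)) ≡ length (others (lookup (zeroWord n) k))
    all-at-distance-1 = ∑-≤-≡ (λ k → count≤length (at k) (others (lookup (zeroWord n) k))) (begin
      ∑[ k < n ] countᵇ (at k) (others (lookup (zeroWord n) k)) ≡⟨ count-neighbours _ (zeroWord n) ⟨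
      countᵇ (λ y → distC C y ≡ᵇ 1) (neighbours (zeroWord n))  ≡⟨ β₀ (zeroWord n) (∈C⇒distC≡0 0∈C) ⟩
      n * 8                                                     ≡⟨ ∑-const n 8 ⟨
      ∑[ k < n ] 8                                              ≡⟨ sum-cong-≗ (λ k → length-others (lookup (zeroWord n) k)) ⟨
      ∑[ k < n ] length (others (lookup (zeroWord n) k))        ∎)
      where open ≡-Reasoning

  unit-∉C : ∀ i {a} → a ≢ 0₉ → C (unit i a) ≢ true
  unit-∉C i a≢0 unit∈C = 0≢1+n (trans (sym (∈C⇒distC≡0 unit∈C)) (distC-unit i a≢0))

  supported-on-one : ∀ {i w} → C w ≡ true → SupportedOn (i ∷ []) w → ∀ m → lookup w m ≡ 0₉
  supported-on-one {i} {w} w∈C supp with lookup w i ≟₉ 0₉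
  ... | yes wᵢ≡0 = λ m → supported-drop {S = []} {w} wᵢ≡0 supp m []
  ... | no  wᵢ≢0 = contradiction (subst (λ y → C y ≡ true) (lookup-ext w≗unit) w∈C) (unit-∉C i wᵢ≢0)
    where
    w≗unit : ∀ m → lookup w m ≡ lookup (unit i (lookup w i)) m
    w≗unit m with m ≟ i
    ... | yes refl = sym (lookup-unit i (lookup w i))
    ... | no  m≢i  = trans (supp m (m≢i ∷ [])) (sym (lookup-unit-≢ (lookup w i) m≢i))

  codeword-neighbours-share-coordinate : ∀ {x k l b b′} → distC C x ≡ 1 →
    b ≢ lookup x k → C (x [ k ]≔ b) ≡ true → b′ ≢ lookup x l → C (x [ l ]≔ b′) ≡ true → k ≡ l
  codeword-neighbours-share-coordinate {x} {k} {l} d≡1 b≢ x[k]≔b∈C b′≢ x[l]≔b′∈C = decidable-stable (k ≟ l) λ k≢l →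
    1+n≰n (begin
      2                                            ≤⟨ +-mono-≤ (codeword-along b≢ x[k]≔b∈C) (+-monoˡ-≤ 0 (codeword-along b′≢ x[l]≔b′∈C)) ⟩
      f k + (f l + 0)                              ≤⟨ ∑-≥-distinct f ((k≢l ∷ []) ∷ [] ∷ []) ⟩
      ∑[ m < n ] f m                               ≡⟨ count-neighbours (λ y → distC C y ≡ᵇ 0) x ⟨
      countᵇ (λ y → distC C y ≡ᵇ 0) (neighbours x) ≡⟨ γ₁ x d≡1 ⟩
      1                                            ∎)
    where
    open ≤-Reasoning
    f : Fin n → ℕ
    f m = countᵇ (λ b → distC C (x [ m ]≔ b) ≡ᵇ 0) (others (lookup x m))
    codeword-along : ∀ {m b} → b ≢ lookup x m → C (x [ m ]≔ b) ≡ true → 1 ≤ f m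
    codeword-along {m} b≢ y∈C = count≥1 _ (others (lookup x m)) (∈-others b≢) (≡ᵇ-true (∈C⇒distC≡0 y∈C))

  supported-on-two : ∀ {i j w} → C w ≡ true → SupportedOn (i ∷ j ∷ []) w → ∀ m → lookup w m ≡ 0₉
  supported-on-two {i} {j} {w} w∈C supp with lookup w i ≟₉ 0₉ | lookup w j ≟₉ 0₉ | i ≟ j
  ... | yes wᵢ≡0 | _        | _        = supported-on-one {j} w∈C (supported-drop {S = j ∷ []} {w} wᵢ≡0 supp)
  ... | _        | yes wⱼ≡0 | _        = supported-on-one {i} w∈C
          (supported-drop {S = i ∷ []} {w} wⱼ≡0 λ { m (m≢j ∷ m≢i ∷ []) → supp m (m≢i ∷ m≢j ∷ []) })
  ... | _        | _        | yes refl = supported-on-one {i} w∈C λ { m (m≢i ∷ []) → supp m (m≢i ∷ m≢i ∷ []) }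
  ... | no wᵢ≢0  | no wⱼ≢0  | no i≢j   = contradiction
          (codeword-neighbours-share-coordinate (distC-unit i wᵢ≢0)
            (λ 0≡xᵢ → wᵢ≢0 (sym (trans 0≡xᵢ (lookup-unit i (lookup w i))))) x[i]≔0∈C
            (λ wⱼ≡xⱼ → wⱼ≢0 (trans wⱼ≡xⱼ (lookup-unit-≢ (lookup w i) (i≢j ∘ sym)))) x[j]≔wⱼ∈C)
          i≢j
    where
    x : Word n
    x = unit i (lookup w i)
    x[i]≔0∈C : C (x [ i ]≔ 0₉) ≡ true
    x[i]≔0∈C = subst (λ y → C y ≡ true) (sym (trans (Vec.[]≔-idempotent (zeroWord n) i) (unit-0 i))) 0∈C
    w≗x[j]≔wⱼ : ∀ m → lookup w m ≡ lookup (x [ j ]≔ lookup w j) m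
    w≗x[j]≔wⱼ m with m ≟ j | m ≟ i
    ... | yes refl | _        = sym (Vec.lookup∘update m x (lookup w m))
    ... | no m≢j   | yes refl = sym (trans (Vec.lookup∘update′ m≢j x (lookup w j)) (lookup-unit m (lookup w m)))
    ... | no m≢j   | no m≢i   = trans (supp m (m≢i ∷ m≢j ∷ []))
                                  (sym (trans (Vec.lookup∘update′ m≢j x (lookup w j)) (lookup-unit-≢ (lookup w i) m≢i)))
    x[j]≔wⱼ∈C : C (x [ j ]≔ lookup w j) ≡ true
    x[j]≔wⱼ∈C = subst (λ y → C y ≡ true) (lookup-ext w≗x[j]≔wⱼ) w∈C

  distC-unit≤1 : ∀ i b → distC C (unit i b) ≤ 1
  distC-unit≤1 i b with b ≟₉ 0₉
  ... | yes refl = ≤-trans (≤-reflexive (trans (cong (distC C) (unit-0 i)) (∈C⇒distC≡0 0∈C))) z≤n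
  ... | no b≢0   = ≤-reflexive (distC-unit i b≢0)

module Lines {n} {C : Code n} (linear : IsLinear C)
  (β₀ : ∀ x → distC C x ≡ 0 → countᵇ (λ y → distC C y ≡ᵇ 1) (neighbours x) ≡ n * 8)
  (γ₁ : ∀ x → distC C x ≡ 1 → countᵇ (λ y → distC C y ≡ᵇ 0) (neighbours x) ≡ 1) where

  open LinearCode linear
  open MinimumDistance linear β₀ γ₁

  record Line (i j k : Fin n) : Set where
    field
      word      : Word n
      codeword  : C word ≡ true
      supported : SupportedOn (i ∷ j ∷ k ∷ []) word
      nonzero₁  : lookup word i ≢ 0₉
      nonzero₂  : lookup word j ≢ 0₉
      nonzero₃  : lookup word k ≢ 0₉

  open Line public

  swap₁₂ : ∀ {i j k} → Line i j k → Line j i k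
  swap₁₂ L = record
    { word = word L ; codeword = codeword L
    ; supported = λ { m (m≢j ∷ m≢i ∷ m≢k ∷ []) → supported L m (m≢i ∷ m≢j ∷ m≢k ∷ []) }
    ; nonzero₁ = nonzero₂ L ; nonzero₂ = nonzero₁ L ; nonzero₃ = nonzero₃ L }

  swap₂₃ : ∀ {i j k} → Line i j k → Line i k j
  swap₂₃ L = record
    { word = word L ; codeword = codeword L
    ; supported = λ { m (m≢i ∷ m≢k ∷ m≢j ∷ []) → supported L m (m≢i ∷ m≢j ∷ m≢k ∷ []) }
    ; nonzero₁ = nonzero₁ L ; nonzero₂ = nonzero₃ L ; nonzero₃ = nonzero₂ L }

  distinct₁₂ : ∀ {i j k} → Line i j k → i ≢ j
  distinct₁₂ L refl =
    nonzero₁ L (supported-on-two (codeword L) (λ { m (m≢i ∷ m≢k ∷ []) → supported L m (m≢i ∷ m≢i ∷ m≢k ∷ []) }) _)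

  distinct₁₃ : ∀ {i j k} → Line i j k → i ≢ k
  distinct₁₃ = distinct₁₂ ∘ swap₂₃

  distinct₂₃ : ∀ {i j k} → Line i j k → j ≢ k
  distinct₂₃ = distinct₁₂ ∘ swap₂₃ ∘ swap₁₂

  normalize : ∀ {i j k} → Line i j k → Σ (Line i j k) λ L → lookup (word L) i ≡ 1₉
  normalize {i} {j} {k} L with inverse (lookup (word L) i) (nonzero₁ L)
  ... | a⁻¹ , a⁻¹a≡1 = record
    { word = map (a⁻¹ ⊗_) (word L)
    ; codeword = proj₂ (proj₂ linear) a⁻¹ (word L) (codeword L)
    ; supported = λ m m∉ → trans (Vec.lookup-map m _ (word L)) (trans (cong (a⁻¹ ⊗_) (supported L m m∉)) (⊗-zeroʳ a⁻¹))
    ; nonzero₁ = scaled-≢0 (nonzero₁ L) ; nonzero₂ = scaled-≢0 (nonzero₂ L) ; nonzero₃ = scaled-≢0 (nonzero₃ L) }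
    , trans (Vec.lookup-map i _ (word L)) a⁻¹a≡1
    where
    a⁻¹≢0 : a⁻¹ ≢ 0₉
    a⁻¹≢0 a⁻¹≡0 = 1≢0 (trans (sym a⁻¹a≡1) (cong (_⊗ lookup (word L) i) a⁻¹≡0))
    scaled-≢0 : ∀ {m} → lookup (word L) m ≢ 0₉ → lookup (map (a⁻¹ ⊗_) (word L)) m ≢ 0₉
    scaled-≢0 {m} wₘ≢0 = ⊗-≢0 a⁻¹ (lookup (word L) m) a⁻¹≢0 wₘ≢0 ∘ trans (sym (Vec.lookup-map m _ (word L)))

  module _ {i j k l} (U : Line i j k) (V : Line i j l) where

    private
      w : Word n
      w = eliminate i (word U) (word V)

      w∈C : C w ≡ true
      w∈C = eliminate-∈C i (codeword U) (codeword V)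

      w-supported : SupportedOn (j ∷ k ∷ j ∷ l ∷ []) w
      w-supported = eliminate-supported i (word U) (word V) (supported U) (supported V)

    cross : F₉
    cross = lookup (word V) i ⊗ lookup (word U) j ⊕ ⊖ lookup (word U) i ⊗ lookup (word V) j

    private
      wⱼ≡cross : lookup w j ≡ cross
      wⱼ≡cross = lookup-eliminate i (word U) (word V) j

      wₖ≢0 : k ≢ l → lookup w k ≢ 0₉
      wₖ≢0 k≢l = ⊗-≢0 _ _ (nonzero₁ V) (nonzero₃ U)
        ∘ trans (sym (eliminate-left i (word U) (word V) (supported V k (distinct₁₃ U ∘ sym ∷ distinct₂₃ U ∘ sym ∷ k≢l ∷ []))))

      wₗ≢0 : k ≢ l → lookup w l ≢ 0₉
      wₗ≢0 k≢l = ⊗-≢0 _ _ (⊖-≢0 _ (nonzero₁ U)) (nonzero₃ V)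
        ∘ trans (sym (eliminate-right i (word U) (word V) (supported U l (distinct₁₃ V ∘ sym ∷ distinct₂₃ V ∘ sym ∷ k≢l ∘ sym ∷ []))))

      wⱼ≢0 : k ≢ l → lookup w j ≢ 0₉
      wⱼ≢0 k≢l wⱼ≡0 = wₖ≢0 k≢l (supported-on-two w∈C off-k-l k)
        where
        off-k-l : SupportedOn (k ∷ l ∷ []) w
        off-k-l m (m≢k ∷ m≢l ∷ []) with m ≟ j
        ... | yes refl = wⱼ≡0
        ... | no m≢j   = w-supported m (m≢j ∷ m≢k ∷ m≢j ∷ m≢l ∷ [])

    same-third⇒cross≡0 : k ≡ l → cross ≡ 0₉
    same-third⇒cross≡0 refl = trans (sym wⱼ≡cross)
      (supported-on-two w∈C (λ { m (m≢j ∷ m≢k ∷ []) → w-supported m (m≢j ∷ m≢k ∷ m≢j ∷ m≢k ∷ []) }) j)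

    distinct-thirds⇒cross≢0 : k ≢ l → cross ≢ 0₉
    distinct-thirds⇒cross≢0 k≢l = wⱼ≢0 k≢l ∘ trans wⱼ≡cross

    distinct-thirds⇒line : k ≢ l → Line j k l
    distinct-thirds⇒line k≢l = record
      { word = w ; codeword = w∈C
      ; supported = λ { m (m≢j ∷ m≢k ∷ m≢l ∷ []) → w-supported m (m≢j ∷ m≢k ∷ m≢j ∷ m≢l ∷ []) }
      ; nonzero₁ = wⱼ≢0 k≢l ; nonzero₂ = wₖ≢0 k≢l ; nonzero₃ = wₗ≢0 k≢l }

    normalized-cross : lookup (word U) i ≡ 1₉ → lookup (word V) i ≡ 1₉ →
                       cross ≡ 1₉ ⊗ lookup (word U) j ⊕ ⊖ 1₉ ⊗ lookup (word V) j
    normalized-cross Uᵢ≡1 Vᵢ≡1 = cong₂ (λ x y → x ⊗ lookup (word U) j ⊕ ⊖ y ⊗ lookup (word V) j) Vᵢ≡1 Uᵢ≡1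

  pair : Fin n → Fin n → F₉ → Word n
  pair i k b = unit i 1₉ [ k ]≔ b

  module _ (i k : Fin n) (b : F₉) where

    lookup-pair₂ : lookup (pair i k b) k ≡ b
    lookup-pair₂ = Vec.lookup∘update k (unit i 1₉) b

    lookup-pair₁ : i ≢ k → lookup (pair i k b) i ≡ 1₉
    lookup-pair₁ i≢k = trans (Vec.lookup∘update′ i≢k (unit i 1₉) b) (lookup-unit i 1₉)

    lookup-pair-off : ∀ {m} → m ≢ i → m ≢ k → lookup (pair i k b) m ≡ 0₉
    lookup-pair-off m≢i m≢k = trans (Vec.lookup∘update′ m≢k (unit i 1₉) b) (lookup-unit-≢ 1₉ m≢i)

    pair-∉C : i ≢ k → C (pair i k b) ≢ true
    pair-∉C i≢k pair∈C = 1≢0 (trans (sym (lookup-pair₁ i≢k))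
      (supported-on-two pair∈C (λ { m (m≢i ∷ m≢k ∷ []) → lookup-pair-off m≢i m≢k }) i))

  line⇒distC≡1 : ∀ {i k m} (L : Line i k m) → lookup (word L) i ≡ 1₉ → distC C (pair i k (lookup (word L) k)) ≡ 1
  line⇒distC≡1 {i} {k} {m} L Lᵢ≡1 =
    ≤-antisym (≤-trans (distC≤ham C (pair i k b) (codeword L)) (ham-≤1 {x = pair i k b} {word L} m agree))
              (∉C⇒distC≥1 (pair-∉C i k b (distinct₁₂ L)))
    where
    b = lookup (word L) k
    agree : ∀ l → l ≢ m → lookup (pair i k b) l ≡ lookup (word L) l
    agree l l≢m with l ≟ k | l ≟ i
    ... | yes refl | _        = lookup-pair₂ i k b
    ... | no l≢k   | yes refl = trans (lookup-pair₁ i k b (distinct₁₂ L)) (sym Lᵢ≡1)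
    ... | no l≢k   | no l≢i   = trans (lookup-pair-off i k b l≢i l≢k) (sym (supported L l (l≢i ∷ l≢k ∷ l≢m ∷ [])))

  distC≡1⇒line : ∀ {i k b} → i ≢ k → b ≢ 0₉ → distC C (pair i k b) ≡ 1 →
                 ∃ λ m → Σ (Line i k m) λ L → lookup (word L) i ≡ 1₉ × lookup (word L) k ≡ b
  distC≡1⇒line {i} {k} {b} i≢k b≢0 d≡1 with distC-attained C (pair i k b) 0∈C
  ... | c , c∈C , d≡ham with ham≡1⇒differ-once {x = pair i k b} {c} (trans (sym d≡ham) d≡1)
  ... | m , differ , agree = m , line , cᵢ≡1 , cₖ≡b
    where
    c-supported : SupportedOn (i ∷ k ∷ m ∷ []) c
    c-supported l (l≢i ∷ l≢k ∷ l≢m ∷ []) = trans (sym (agree l l≢m)) (lookup-pair-off i k b l≢i l≢k)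
    m≢i : m ≢ i
    m≢i refl = b≢0 (trans (sym (trans (sym (agree k (i≢k ∘ sym))) (lookup-pair₂ i k b)))
      (supported-on-two c∈C (λ { l (l≢i ∷ l≢k ∷ []) → c-supported l (l≢i ∷ l≢k ∷ l≢i ∷ []) }) k))
    m≢k : m ≢ k
    m≢k refl = 1≢0 (trans (sym (trans (sym (agree i i≢k)) (lookup-pair₁ i k b i≢k)))
      (supported-on-two c∈C (λ { l (l≢i ∷ l≢k ∷ []) → c-supported l (l≢i ∷ l≢k ∷ l≢k ∷ []) }) i))
    cᵢ≡1 : lookup c i ≡ 1₉
    cᵢ≡1 = trans (sym (agree i (m≢i ∘ sym))) (lookup-pair₁ i k b i≢k)
    cₖ≡b : lookup c k ≡ b
    cₖ≡b = trans (sym (agree k (m≢k ∘ sym))) (lookup-pair₂ i k b)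
    line : Line i k m
    line = record
      { word = c ; codeword = c∈C ; supported = c-supported
      ; nonzero₁ = λ cᵢ≡0 → 1≢0 (trans (sym cᵢ≡1) cᵢ≡0)
      ; nonzero₂ = λ cₖ≡0 → b≢0 (trans (sym cₖ≡b) cₖ≡0)
      ; nonzero₃ = λ cₘ≡0 → differ (trans (lookup-pair-off i k b m≢i m≢k) (sym cₘ≡0)) }

  is-ratio : Fin n → Fin n → F₉ → Bool
  is-ratio i k b = distC C (pair i k b) ≡ᵇ 1

  ratio-intro : ∀ {i k b} → distC C (pair i k b) ≡ 1 → is-ratio i k b ≡ true
  ratio-intro {i} {k} {b} = ≡ᵇ-true {distC C (pair i k b)} {1}

  ratio-elim : ∀ {i k b} → is-ratio i k b ≡ true → distC C (pair i k b) ≡ 1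
  ratio-elim {i} {k} {b} = ≡ᵇ-sound (distC C (pair i k b)) 1

  normalized-ratio : ∀ {i k m} (L : Line i k m) → lookup (word L) i ≡ 1₉ →
                     lookup (word L) k ∈ others 0₉ × is-ratio i k (lookup (word L) k) ≡ true
  normalized-ratio L Lᵢ≡1 = ∈-others (nonzero₂ L) , ratio-intro (line⇒distC≡1 L Lᵢ≡1)

  pair-distC≤2 : ∀ i k b → distC C (pair i k b) ≤ 2
  pair-distC≤2 i k b = ≤-trans (distC≤ham C (pair i k b) 0∈C)
    (≤-trans (ham-triangle (pair i k b) (unit i 1₉) (zeroWord n))
             (+-mono-≤ (ham-≤1 {x = pair i k b} {unit i 1₉} k λ l l≢k → Vec.lookup∘update′ l≢k (unit i 1₉) b)
                       (ham-≤1 {x = unit i 1₉} {zeroWord n} i λ l l≢i → trans (lookup-unit-≢ 1₉ l≢i) (sym (lookup-zeroWord l)))))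

  supported-on-three : ∀ {a b c w} → C w ≡ true → SupportedOn (a ∷ b ∷ c ∷ []) w → (∀ m → lookup w m ≡ 0₉) ⊎ Line a b c
  supported-on-three {a} {b} {c} {w} w∈C supp with lookup w a ≟₉ 0₉ | lookup w b ≟₉ 0₉ | lookup w c ≟₉ 0₉
  ... | yes wₐ≡0 | _ | _ = inj₁ (supported-on-two w∈C (supported-drop {S = b ∷ c ∷ []} {w} wₐ≡0 supp))
  ... | _ | yes w_b≡0 | _ = inj₁ (supported-on-two w∈C (supported-drop {S = a ∷ c ∷ []} {w} w_b≡0
        λ { m (m≢b ∷ m≢a ∷ m≢c ∷ []) → supp m (m≢a ∷ m≢b ∷ m≢c ∷ []) }))
  ... | _ | _ | yes w_c≡0 = inj₁ (supported-on-two w∈C (supported-drop {S = a ∷ b ∷ []} {w} w_c≡0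
        λ { m (m≢c ∷ m≢a ∷ m≢b ∷ []) → supp m (m≢a ∷ m≢b ∷ m≢c ∷ []) }))
  ... | no wₐ≢0 | no w_b≢0 | no w_c≢0 = inj₂ record
    { word = w ; codeword = w∈C ; supported = supp ; nonzero₁ = wₐ≢0 ; nonzero₂ = w_b≢0 ; nonzero₃ = w_c≢0 }

  -- N i k counts the b ≠ 0 with e_i + b e_k at distance 1, i.e. the ratios c_k / c_i of lines c
  -- through i and k.  It is opaque: unfolding it at n = 7 makes the type checker enumerate F₉⁷.
  opaque
    N : Fin n → Fin n → ℕ
    N i k = countᵇ (is-ratio i k) (others 0₉)

    line⇒N≥1 : ∀ {i k m} → Line i k m → 1 ≤ N i k
    line⇒N≥1 {i} {k} L = let (b∈ , ratio) = uncurry normalized-ratio (normalize L) in count≥1 (is-ratio i k) (others 0₉) b∈ ratio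

    N≥1⇒line : ∀ {i k} → i ≢ k → 1 ≤ N i k → ∃ λ m → Line i k m
    N≥1⇒line {i} {k} i≢k 1≤N with count≥1⇒∃ (is-ratio i k) (others 0₉) 1≤N
    ... | b , b∈ , d≡1 with distC≡1⇒line i≢k (∈-others⁻ b∈) (ratio-elim d≡1)
    ...   | m , L , _ = m , L

    lines⇒N≥2 : ∀ {i k m l} → Line i k m → Line i k l → m ≢ l → 2 ≤ N i k
    lines⇒N≥2 {i} {k} U V m≢l =
      let (U′ , U′ᵢ≡1) = normalize U ; (V′ , V′ᵢ≡1) = normalize V
          (b∈ , ratio) = normalized-ratio U′ U′ᵢ≡1 ; (b′∈ , ratio′) = normalized-ratio V′ V′ᵢ≡1
          ratios-differ : lookup (word U′) k ≢ lookup (word V′) k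
          ratios-differ Uₖ≡Vₖ = distinct-thirds⇒cross≢0 U′ V′ m≢l
            (trans (normalized-cross U′ V′ U′ᵢ≡1 V′ᵢ≡1)
                   (trans (cong (λ y → 1₉ ⊗ lookup (word U′) k ⊕ ⊖ 1₉ ⊗ y) (sym Uₖ≡Vₖ))
                          (solve 1 (λ a → con 1₉ :* a :+ :- con 1₉ :* a := con 0₉) refl (lookup (word U′) k))))
      in count≥2 (is-ratio i k) (others 0₉) ratios-differ b∈ b′∈ ratio ratio′

    N≥2⇒lines : ∀ {i k} → i ≢ k → 2 ≤ N i k → ∃₂ λ m l → m ≢ l × Line i k m × Line i k l
    N≥2⇒lines {i} {k} i≢k 2≤N with count≥2⇒∃₂ (is-ratio i k) (others-unique 0₉) 2≤N
    ... | b , b′ , b≢b′ , b∈ , b′∈ , d≡1 , d′≡1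
      with distC≡1⇒line i≢k (∈-others⁻ b∈) (ratio-elim d≡1) | distC≡1⇒line i≢k (∈-others⁻ b′∈) (ratio-elim d′≡1)
    ... | m , U , Uᵢ≡1 , Uₖ≡b | l , V , Vᵢ≡1 , Vₖ≡b′ = m , l , thirds-differ , U , V
      where
      thirds-differ : m ≢ l
      thirds-differ m≡l = b≢b′ (1⊗a⊕⊖1⊗b≡0⇒a≡b b b′
        (trans (sym (trans (normalized-cross U V Uᵢ≡1 Vᵢ≡1) (cong₂ (λ x y → 1₉ ⊗ x ⊕ ⊖ 1₉ ⊗ y) Uₖ≡b Vₖ≡b′)))
               (same-third⇒cross≡0 U V m≡l)))

    N-diagonal : ∀ i → N i i ≡ 8
    N-diagonal i = count-all (is-ratio i i) (others 0₉) λ {b} b∈ →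
      ratio-intro (trans (cong (distC C) (Vec.[]≔-idempotent (zeroWord n) i)) (distC-unit i (∈-others⁻ b∈)))

    -- A neighbour of e_i changed in coordinate k ≠ i is at distance 1 or 2.
    distance-2-along+N≡8 : ∀ i k → countᵇ (λ b → distC C (pair i k b) ≡ᵇ 2) (others (lookup (unit i 1₉) k)) + N i k ≡ 8
    distance-2-along+N≡8 i k = by-cases (i ≟ k)
      where
      by-cases : Dec (i ≡ k) → countᵇ (λ b → distC C (pair i k b) ≡ᵇ 2) (others (lookup (unit i 1₉) k)) + N i k ≡ 8
      by-cases (yes refl) = cong₂ _+_ none-at-distance-2 (N-diagonal i)
        where
        none-at-distance-2 : countᵇ (λ b → distC C (pair i i b) ≡ᵇ 2) (others (lookup (unit i 1₉) i)) ≡ 0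
        none-at-distance-2 = count-none _ (others (lookup (unit i 1₉) i)) λ {b} _ →
          ≡ᵇ-false λ d≡2 → 1+n≰n (≤-trans (s≤s (s≤s z≤n))
            (subst (_≤ 1) (trans (cong (distC C) (sym (Vec.[]≔-idempotent (zeroWord n) i))) d≡2) (distC-unit≤1 i b)))
      by-cases (no i≢k) = begin
        countᵇ (λ b → distC C (pair i k b) ≡ᵇ 2) (others (lookup (unit i 1₉) k)) + N i k
          ≡⟨ cong (λ a → countᵇ (λ b → distC C (pair i k b) ≡ᵇ 2) (others a) + N i k) (lookup-unit-≢ 1₉ (i≢k ∘ sym)) ⟩
        countᵇ (λ b → distC C (pair i k b) ≡ᵇ 2) (others 0₉) + N i k
          ≡⟨ count-complement _ (is-ratio i k) (others 0₉)
               (λ {b} _ → ≡ᵇ2≡not≡ᵇ1 (∉C⇒distC≥1 (pair-∉C i k b i≢k)) (pair-distC≤2 i k b)) ⟩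
        8 ∎
        where open ≡-Reasoning

    distance-2+∑N : ∀ i → countᵇ (λ y → distC C y ≡ᵇ 2) (neighbours (unit i 1₉)) + ∑[ k < n ] N i k ≡ n * 8
    distance-2+∑N i = begin
      countᵇ (λ y → distC C y ≡ᵇ 2) (neighbours (unit i 1₉)) + ∑[ k < n ] N i k
        ≡⟨ cong (_+ ∑[ k < n ] N i k) (count-neighbours (λ y → distC C y ≡ᵇ 2) (unit i 1₉)) ⟩
      ∑[ k < n ] along k + ∑[ k < n ] N i k   ≡⟨ ∑-distrib-+ along (N i) ⟨
      ∑[ k < n ] (along k + N i k)            ≡⟨ sum-cong-≗ (distance-2-along+N≡8 i) ⟩
      ∑[ k < n ] 8                            ≡⟨ ∑-const n 8 ⟩
      n * 8                                   ∎
      where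
      open ≡-Reasoning
      along : Fin n → ℕ
      along k = countᵇ (λ b → distC C (pair i k b) ≡ᵇ 2) (others (lookup (unit i 1₉) k))

∑-8-at-i-else-1 : ∀ (i : Fin 7) → ∑[ k < 7 ] (if does (k ≟ i) then 8 else 1) ≡ 14
∑-8-at-i-else-1 zero = refl
∑-8-at-i-else-1 (suc zero) = refl
∑-8-at-i-else-1 (suc (suc zero)) = refl
∑-8-at-i-else-1 (suc (suc (suc zero))) = refl
∑-8-at-i-else-1 (suc (suc (suc (suc zero)))) = refl
∑-8-at-i-else-1 (suc (suc (suc (suc (suc zero))))) = refl
∑-8-at-i-else-1 (suc (suc (suc (suc (suc (suc zero)))))) = refl

module FanoPlane {C : Code 7} (linear : IsLinear C)
  (β₀ : ∀ x → distC C x ≡ 0 → countᵇ (λ y → distC C y ≡ᵇ 1) (neighbours x) ≡ 7 * 8)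
  (γ₁ : ∀ x → distC C x ≡ 1 → countᵇ (λ y → distC C y ≡ᵇ 0) (neighbours x) ≡ 1)
  (β₁ : ∀ x → distC C x ≡ 1 → countᵇ (λ y → distC C y ≡ᵇ 2) (neighbours x) ≡ 42) where

  open LinearCode linear
  open MinimumDistance linear β₀ γ₁
  open Lines linear β₀ γ₁

  -- The implicit 1₉ is given: inferring it would make the type checker unfold distC at length 7.
  ∑N≡14 : ∀ i → ∑[ k < 7 ] N i k ≡ 14
  ∑N≡14 i = +-cancelˡ-≡ 42 _ _
    (trans (cong (_+ ∑[ k < 7 ] N i k) (sym (β₁ (unit i 1₉) (distC-unit i {1₉} 1≢0)))) (distance-2+∑N i))

  N≤1⇒N≡1 : ∀ {i} → (∀ {k} → i ≢ k → N i k ≤ 1) → ∀ {k} → i ≢ k → N i k ≡ 1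
  N≤1⇒N≡1 {i} N≤1 {k} i≢k =
    trans (∑-≤-≡ {f = N i} {g = bound} bounded (trans (∑N≡14 i) (sym (∑-8-at-i-else-1 i))) k) (off-diagonal (k ≟ i))
    where
    bound : Fin 7 → ℕ
    bound m = if does (m ≟ i) then 8 else 1
    bounded : ∀ m → N i m ≤ bound m
    bounded m = by-cases (m ≟ i)
      where
      by-cases : (m≟i : Dec (m ≡ i)) → N i m ≤ (if does m≟i then 8 else 1)
      by-cases (yes refl) = ≤-reflexive (N-diagonal m)
      by-cases (no m≢i)   = N≤1 (m≢i ∘ sym)
    off-diagonal : (k≟i : Dec (k ≡ i)) → (if does k≟i then 8 else 1) ≡ 1
    off-diagonal (yes k≡i) = contradiction (sym k≡i) i≢k
    off-diagonal (no _)    = refl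

  -- N i i = 8 and N i x ≥ 2 for x = j, k, l already use up ∑ N i = 14.
  tetrahedron-closed : ∀ {i j k l m} → Line i j k → Line i j l → Line i k l → All (m ≢_) (i ∷ j ∷ k ∷ l ∷ []) → N i m ≡ 0
  tetrahedron-closed {i} {j} {k} {l} {m} ijk ijl ikl (m≢i ∷ m≢j ∷ m≢k ∷ m≢l ∷ []) =
    trans (sym (+-identityʳ (N i m))) (n≤0⇒n≡0 (+-cancelˡ-≤ 14 (N i m + 0) 0 (begin
      14 + (N i m + 0)                                   ≤⟨ +-monoʳ-≤ 8 (+-mono-≤ Nᵢⱼ≥2 (+-mono-≤ Nᵢₖ≥2 (+-monoˡ-≤ (N i m + 0) Nᵢₗ≥2))) ⟩
      8 + (N i j + (N i k + (N i l + (N i m + 0))))      ≡⟨ cong (_+ (N i j + (N i k + (N i l + (N i m + 0))))) (N-diagonal i) ⟨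
      N i i + (N i j + (N i k + (N i l + (N i m + 0))))  ≤⟨ ∑-≥-distinct (N i) distinct ⟩
      ∑[ k < 7 ] N i k                                   ≡⟨ ∑N≡14 i ⟩
      14 + 0                                             ∎)))
    where
    open ≤-Reasoning
    Nᵢⱼ≥2 : 2 ≤ N i j
    Nᵢⱼ≥2 = lines⇒N≥2 ijk ijl (distinct₂₃ ikl)
    Nᵢₖ≥2 : 2 ≤ N i k
    Nᵢₖ≥2 = lines⇒N≥2 (swap₂₃ ijk) ikl (distinct₂₃ ijl)
    Nᵢₗ≥2 : 2 ≤ N i l
    Nᵢₗ≥2 = lines⇒N≥2 (swap₂₃ ijl) (swap₂₃ ikl) (distinct₂₃ ijk)
    distinct : Unique (i ∷ j ∷ k ∷ l ∷ m ∷ [])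
    distinct = (distinct₁₂ ijk ∷ distinct₁₃ ijk ∷ distinct₁₃ ijl ∷ ≢-sym m≢i ∷ [])
             ∷ (distinct₂₃ ijk ∷ distinct₂₃ ijl ∷ ≢-sym m≢j ∷ [])
             ∷ (distinct₂₃ ikl ∷ ≢-sym m≢k ∷ [])
             ∷ (≢-sym m≢l ∷ [])
             ∷ [] ∷ []

  -- No line joins a point p off the tetrahedron to it; since N p m ≤ 1 (otherwise eight points
  -- would be distinct), the count ∑ N p = 14 still forces a line from p to i.
  no-tetrahedron : ∀ {i j k l} → Line i j k → Line i j l → Line i k l → Line j k l → ⊥
  no-tetrahedron {i} {j} {k} {l} ijk ijl ikl jkl =
    let (p , p∉) = missing-point (i ∷ j ∷ k ∷ l ∷ []) (s≤s (s≤s (s≤s (s≤s (s≤s z≤n)))))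
        p≢i = All.head p∉
        (_ , pit) = N≥1⇒line p≢i (≤-reflexive (sym (N≤1⇒N≡1 (N≤1 p p∉) p≢i)))
    in All.lookup (avoids-tetrahedron p∉ pit) (here refl) refl
    where
    outside⇒N≡0 : ∀ {p} → All (p ≢_) (i ∷ j ∷ k ∷ l ∷ []) → All (λ x → N x p ≡ 0) (i ∷ j ∷ k ∷ l ∷ [])
    outside⇒N≡0 (p≢i ∷ p≢j ∷ p≢k ∷ p≢l ∷ []) =
        tetrahedron-closed ijk ijl ikl (p≢i ∷ p≢j ∷ p≢k ∷ p≢l ∷ [])
      ∷ tetrahedron-closed (swap₁₂ ijk) (swap₁₂ ijl) jkl (p≢j ∷ p≢i ∷ p≢k ∷ p≢l ∷ [])
      ∷ tetrahedron-closed (swap₁₂ (swap₂₃ ijk)) (swap₁₂ ikl) (swap₁₂ jkl) (p≢k ∷ p≢i ∷ p≢j ∷ p≢l ∷ [])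
      ∷ tetrahedron-closed (swap₁₂ (swap₂₃ ijl)) (swap₁₂ (swap₂₃ ikl)) (swap₁₂ (swap₂₃ jkl)) (p≢l ∷ p≢i ∷ p≢j ∷ p≢k ∷ [])
      ∷ []
    avoids-tetrahedron : ∀ {p y t} → All (p ≢_) (i ∷ j ∷ k ∷ l ∷ []) → Line p y t → All (y ≢_) (i ∷ j ∷ k ∷ l ∷ [])
    avoids-tetrahedron p∉ pyt = All.map (λ { Nₓₚ≡0 refl → 1+n≰n (subst (1 ≤_) Nₓₚ≡0 (line⇒N≥1 (swap₁₂ pyt))) })
                                       (outside⇒N≡0 p∉)
    N≤1 : ∀ p → All (p ≢_) (i ∷ j ∷ k ∷ l ∷ []) → ∀ {m} → p ≢ m → N p m ≤ 1
    N≤1 p p∉ {m} p≢m = ≮⇒≥ λ 2≤N →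
      let (m′ , l′ , m′≢l′ , pmm′ , pml′) = N≥2⇒lines p≢m 2≤N
          eight-points : Unique (m ∷ m′ ∷ l′ ∷ p ∷ i ∷ j ∷ k ∷ l ∷ [])
          eight-points =
              (distinct₂₃ pmm′ ∷ distinct₂₃ pml′ ∷ ≢-sym p≢m ∷ avoids-tetrahedron p∉ pmm′)
            ∷ (m′≢l′ ∷ ≢-sym (distinct₁₃ pmm′) ∷ avoids-tetrahedron p∉ (swap₂₃ pmm′))
            ∷ (≢-sym (distinct₁₃ pml′) ∷ avoids-tetrahedron p∉ (swap₂₃ pml′))
            ∷ p∉
            ∷ (distinct₁₂ ijk ∷ distinct₁₃ ijk ∷ distinct₁₃ ijl ∷ [])
            ∷ (distinct₂₃ ijk ∷ distinct₂₃ ijl ∷ [])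
            ∷ (distinct₂₃ ikl ∷ [])
            ∷ [] ∷ []
      in 1+n≰n (unique-length≤ eight-points)

  N≤1 : ∀ {i k} → i ≢ k → N i k ≤ 1
  N≤1 i≢k = ≮⇒≥ λ 2≤N →
    let (m , l , m≢l , ikm , ikl) = N≥2⇒lines i≢k 2≤N
    in no-tetrahedron ikm ikl (distinct-thirds⇒line (swap₁₂ ikm) (swap₁₂ ikl) m≢l) (distinct-thirds⇒line ikm ikl m≢l)

  line-through : ∀ {i j} → i ≢ j → ∃ λ k → Line i j k
  line-through i≢j = N≥1⇒line i≢j (≤-reflexive (sym (N≤1⇒N≡1 N≤1 i≢j)))

  third-unique : ∀ {i j k l} → Line i j k → Line i j l → k ≡ l
  third-unique {k = k} {l} ijk ijl = decidable-stable (k ≟ l) λ k≢l →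
    1+n≰n (≤-trans (lines⇒N≥2 ijk ijl k≢l) (N≤1 (distinct₁₂ ijk)))

  third-avoids : ∀ {u v t q r} → Line u v t → Line u q r → v ≢ r → t ≢ q
  third-avoids uvt uqr v≢r refl = v≢r (third-unique (swap₂₃ uvt) uqr)

  off-line⇒zero : ∀ {r y z x w} → C w ≡ true → SupportedOn (r ∷ y ∷ z ∷ []) w → Line y z x → r ≢ x →
                  ∀ m → lookup w m ≡ 0₉
  off-line⇒zero w∈C supp yzx r≢x =
    [ (λ w≡0 → w≡0) , (λ ryz → contradiction (third-unique (swap₂₃ (swap₁₂ ryz)) yzx) r≢x) ]′ (supported-on-three w∈C supp)

  -- Eliminating p and q leaves a codeword on {r, x, y, z}; eliminating x with c₄ leaves one on
  -- {r, y, z}, which is not a line and so vanishes.  Its value at r is the determinant below.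
  triangle-relation : ∀ {p q r x y z} (c₁ : Line p q x) (c₂ : Line p r y) (c₃ : Line q r z) → Line x y z → r ≢ x → q ≢ y →
                      lookup (word c₃) q ⊗ (⊖ lookup (word c₁) p ⊗ lookup (word c₂) r)
                        ⊕ ⊖ (lookup (word c₂) p ⊗ lookup (word c₁) q) ⊗ lookup (word c₃) r ≡ 0₉
  triangle-relation {p} {q} {r} {x} {y} {z} c₁ c₂ c₃ c₄ r≢x q≢y =
    trans (sym (trans w₂ᵣ (cong₂ (λ s t → lookup (word c₃) q ⊗ s ⊕ ⊖ t ⊗ lookup (word c₃) r) w₁ᵣ w₁q)))
          (a⊗b≡0⇒b≡0 (lookup (word c₄) x) (lookup w₂ r) (nonzero₁ c₄) (trans (sym w₃ᵣ) (w₃≡0 r)))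
    where
    w₁ w₂ w₃ : Word 7
    w₁ = eliminate p (word c₁) (word c₂)
    w₂ = eliminate q w₁ (word c₃)
    w₃ = eliminate x w₂ (word c₄)
    w₁-supported : SupportedOn (q ∷ x ∷ r ∷ y ∷ []) w₁
    w₁-supported = eliminate-supported p (word c₁) (word c₂) (supported c₁) (supported c₂)
    w₂-supported : SupportedOn (x ∷ r ∷ y ∷ r ∷ z ∷ []) w₂
    w₂-supported = eliminate-supported q w₁ (word c₃) w₁-supported (supported c₃)
    w₃-supported : SupportedOn (r ∷ y ∷ r ∷ z ∷ y ∷ z ∷ []) w₃
    w₃-supported = eliminate-supported x w₂ (word c₄) w₂-supported (supported c₄)
    w₃∈C : C w₃ ≡ true
    w₃∈C = eliminate-∈C x (eliminate-∈C q (eliminate-∈C p (codeword c₁) (codeword c₂)) (codeword c₃)) (codeword c₄)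
    w₃≡0 : ∀ m → lookup w₃ m ≡ 0₉
    w₃≡0 = off-line⇒zero w₃∈C (λ { m (m≢r ∷ m≢y ∷ m≢z ∷ []) → w₃-supported m (m≢r ∷ m≢y ∷ m≢r ∷ m≢z ∷ m≢y ∷ m≢z ∷ []) })
                         (swap₂₃ (swap₁₂ c₄)) r≢x
    w₁q : lookup w₁ q ≡ lookup (word c₂) p ⊗ lookup (word c₁) q
    w₁q = eliminate-left p (word c₁) (word c₂) (supported c₂ q (distinct₁₂ c₁ ∘ sym ∷ distinct₁₂ c₃ ∷ q≢y ∷ []))
    w₁ᵣ : lookup w₁ r ≡ ⊖ lookup (word c₁) p ⊗ lookup (word c₂) r
    w₁ᵣ = eliminate-right p (word c₁) (word c₂) (supported c₁ r (distinct₁₂ c₂ ∘ sym ∷ distinct₁₂ c₃ ∘ sym ∷ r≢x ∷ []))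
    w₂ᵣ : lookup w₂ r ≡ lookup (word c₃) q ⊗ lookup w₁ r ⊕ ⊖ lookup w₁ q ⊗ lookup (word c₃) r
    w₂ᵣ = lookup-eliminate q w₁ (word c₃) r
    w₃ᵣ : lookup w₃ r ≡ lookup (word c₄) x ⊗ lookup w₂ r
    w₃ᵣ = eliminate-left x w₂ (word c₄) (supported c₄ r (r≢x ∷ distinct₂₃ c₂ ∷ distinct₂₃ c₃ ∷ []))

  fano-lines-inconsistent : ∀ {X A B P D Y Z} → Line X A B → Line X P D → Line A P Y → Line B P Z →
                            Line B D Y → Line A D Z → Line X Y Z → ⊥
  fano-lines-inconsistent {X} {A} {B} {P} {D} {Y} {Z} XAB XPD APY BPZ BDY ADZ XYZ =
    fano-relations-inconsistent
      (lookup (word XAB) X) (lookup (word XAB) A) (lookup (word XPD) X) (lookup (word XPD) P) (lookup (word XPD) D)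
      (lookup (word APY) A) (lookup (word APY) P) (lookup (word ADZ) A) (lookup (word ADZ) D)
      (nonzero₁ XPD) (nonzero₂ XAB) (nonzero₂ APY) (nonzero₃ XPD) (nonzero₁ ADZ)
      (triangle-relation XAB XPD APY BDY (≢-sym (distinct₁₂ BPZ)) (distinct₁₂ ADZ))
      (triangle-relation XAB (swap₂₃ XPD) ADZ BPZ (≢-sym (distinct₁₂ BDY)) (distinct₁₂ APY))
      (triangle-relation (swap₂₃ (swap₁₂ XPD)) (swap₁₂ APY) (swap₁₂ ADZ) XYZ (≢-sym (distinct₁₂ XAB)) (distinct₂₃ BDY))

  -- The seven points are distinct, so the third point of BD, AD or XY is one of them, and
  -- third-avoids excludes all candidates but one.
  module FanoCompletion {X A B P D Y Z} (XAB : Line X A B) (XPD : Line X P D) (APY : Line A P Y) (BPZ : Line B P Z)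
                        (P∉ : All (P ≢_) (X ∷ A ∷ B ∷ [])) where

    private
      P≢X = All.lookup P∉ (here refl)
      P≢A = All.lookup P∉ (there (here refl))
      P≢B = All.lookup P∉ (there (there (here refl)))
      XBA = swap₂₃ XAB
      AXB = swap₁₂ XAB
      ABX = swap₂₃ AXB
      BXA = swap₁₂ XBA
      BAX = swap₁₂ ABX
      XDP = swap₂₃ XPD
      PDX = swap₂₃ (swap₁₂ XPD)
      PAY = swap₁₂ APY
      AYP = swap₂₃ APY
      PBZ = swap₁₂ BPZ
      BZP = swap₂₃ BPZ
      D≢A = third-avoids XPD XAB P≢B
      D≢B = third-avoids XPD XBA P≢A
      Y≢X = third-avoids APY AXB P≢B
      Y≢B = third-avoids APY ABX P≢X
      Y≢D = third-avoids PAY PDX (≢-sym (distinct₁₂ XAB))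
      Z≢X = third-avoids BPZ BXA P≢A
      Z≢A = third-avoids BPZ BAX P≢X
      Z≢D = third-avoids PBZ PDX (≢-sym (distinct₁₃ XAB))
      Z≢Y = third-avoids PBZ (swap₂₃ PAY) (≢-sym (distinct₂₃ XAB))

      seven-points : Unique (X ∷ A ∷ B ∷ P ∷ D ∷ Y ∷ Z ∷ [])
      seven-points =
          (distinct₁₂ XAB ∷ distinct₁₃ XAB ∷ ≢-sym P≢X ∷ distinct₁₃ XPD ∷ ≢-sym Y≢X ∷ ≢-sym Z≢X ∷ [])
        ∷ (distinct₂₃ XAB ∷ ≢-sym P≢A ∷ ≢-sym D≢A ∷ distinct₁₃ APY ∷ ≢-sym Z≢A ∷ [])
        ∷ (≢-sym P≢B ∷ ≢-sym D≢B ∷ ≢-sym Y≢B ∷ distinct₁₃ BPZ ∷ [])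
        ∷ (distinct₂₃ XPD ∷ distinct₂₃ APY ∷ distinct₂₃ BPZ ∷ [])
        ∷ (≢-sym Y≢D ∷ ≢-sym Z≢D ∷ [])
        ∷ (≢-sym Z≢Y ∷ [])
        ∷ [] ∷ []

      listed : ∀ t → t ∈ X ∷ A ∷ B ∷ P ∷ D ∷ Y ∷ Z ∷ []
      listed = every-point-listed seven-points refl

    BDY : Line B D Y
    BDY = let (T , BDT) = line-through (≢-sym D≢B) in
      subst (Line B D) (only-candidate (X ∷ A ∷ B ∷ P ∷ D ∷ []) (Z ∷ []) (listed T)
        (third-avoids BDT BXA D≢A ∷ third-avoids BDT BAX (≢-sym (distinct₁₃ XPD)) ∷ ≢-sym (distinct₁₃ BDT)
          ∷ third-avoids BDT BPZ (≢-sym Z≢D) ∷ ≢-sym (distinct₂₃ BDT) ∷ [])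
        (third-avoids BDT BZP (≢-sym (distinct₂₃ XPD)) ∷ []))
        BDT

    ADZ : Line A D Z
    ADZ = let (T , ADT) = line-through (≢-sym D≢A) in
      subst (Line A D) (only-candidate (X ∷ A ∷ B ∷ P ∷ D ∷ Y ∷ []) [] (listed T)
        (third-avoids ADT AXB D≢B ∷ ≢-sym (distinct₁₃ ADT) ∷ third-avoids ADT ABX (≢-sym (distinct₁₃ XPD))
          ∷ third-avoids ADT APY (≢-sym Y≢D) ∷ ≢-sym (distinct₂₃ ADT) ∷ third-avoids ADT AYP (≢-sym (distinct₂₃ XPD)) ∷ [])
        [])
        ADT

    XYZ : Line X Y Z
    XYZ = let (T , XYT) = line-through (≢-sym Y≢X) in
      subst (Line X Y) (only-candidate (X ∷ A ∷ B ∷ P ∷ D ∷ Y ∷ []) [] (listed T)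
        (≢-sym (distinct₁₃ XYT) ∷ third-avoids XYT XAB Y≢B ∷ third-avoids XYT XBA (≢-sym (distinct₁₃ APY))
          ∷ third-avoids XYT XPD Y≢D ∷ third-avoids XYT XDP (≢-sym (distinct₂₃ APY)) ∷ ≢-sym (distinct₂₃ XYT) ∷ [])
        [])
        XYT

  no-such-code : ⊥
  no-such-code =
    let (B , XAB) = line-through {zero} {suc zero} (λ ())
        (P , P∉) = missing-point (zero ∷ suc zero ∷ B ∷ []) (s≤s (s≤s (s≤s (s≤s z≤n))))
        (D , XPD) = line-through (≢-sym (All.lookup P∉ (here refl)))
        (Y , APY) = line-through (≢-sym (All.lookup P∉ (there (here refl))))
        (Z , BPZ) = line-through (≢-sym (All.lookup P∉ (there (there (here refl)))))
        open FanoCompletion XAB XPD APY BPZ P∉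
    in fano-lines-inconsistent XAB XPD APY BPZ BDY ADZ XYZ

corollary6 : ¬ (Σ (Code 7) λ C → IsLinear C ×
    IsCompletelyRegularWithArray C 3 (56 ∷ 42 ∷ 20 ∷ []) (1 ∷ 6 ∷ 28 ∷ []))
corollary6 (C , linear , _ , _ , β , γ) =
  FanoPlane.no-such-code linear (λ x → β x zero) (λ x → γ x zero) (λ x → β x (suc zero))
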